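{- Let $G\in\mathcal{U}(N,k)$ with cycle $C$, let $x\sim u\sim y$ be consecutive vertices of $C$, and let $w,v$ be vertices not on $C$ with $u\sim w\sim v$, $d(w)=2$ and $d(v)\ge 3$. Write $N(u)=\{x,y,w\}\cup\{u_1,\dots,u_n\}$ ($n\ge 0$) and $N(v)=\{w\}\cup\{v_1,\dots,v_m\}$. Let $T^*$ be the connected component containing $w$ and $v$ of the graph obtained from $G$ by deleting the edge $uw$ (a tree), and assume that $v$ is the only vertex of $T^*$ of degree at least $3$. Then: (a) if $d(u)\ge d(v)$ and $G^*$ is obtained from $G$ by deleting the edges $vv_i$ and adding the edges $uv_i$ for all $2\le i\le m$, then $SO(G^*)>SO(G)$; (b) if $d(v)>d(u)$ and $G^*$ is obtained from $G$ by deleting the edges $uu_i$ ($1\le i\le n$) and $ux$ and adding the edges $vu_i$ ($1\le i\le n$) and $vx$, then $SO(G^*)>SO(G)$.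
   Context: All graphs are finite, simple and connected. For a graph $G$ with vertex degrees $d(\cdot)$, the Sombor index is $SO(G)=\sum_{ab\in E(G)}\sqrt{d(a)^2+d(b)^2}$. $N(a)$ denotes the set of neighbours of $a$. A pendant vertex is a vertex of degree $1$. $\mathcal{U}(N,k)$ is the class of connected unicyclic graphs (exactly one cycle) on $N$ vertices with exactly $k$ pendant vertices. -}

module Defs where

open import Data.Nat using (ℕ; zero; suc; _+_; _*_; _^_; _≤_; _<ᵇ_)
open import Data.Bool using (Bool; true; false; if_then_else_; _∧_; _∨_; not)
open import Data.Fin using (Fin; toℕ; _≟_)
open import Data.List using (List; []; _∷_; _++_; [_]; map; concatMap; allFin; zip; length; foldr)
open import Data.List.Membership.Propositional using (_∈_)
open import Data.List.Relation.Unary.All using (All)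
open import Data.List.Relation.Unary.Unique.Propositional using (Unique)
open import Data.List.Relation.Binary.Pointwise using (Pointwise)
open import Data.Product using (_×_; _,_; ∃; ∃-syntax)
open import Data.Sum using (_⊎_)
open import Data.Integer using (+_)
import Data.Rational as Q
open import Relation.Nullary.Decidable using (⌊_⌋)
open import Relation.Binary.PropositionalEquality using (_≡_)
open import Function.Bundles using (_⇔_)

Adj : ℕ → Set
Adj N = Fin N → Fin N → Bool

Simple : ∀ {N} → Adj N → Set
Simple G = (∀ a b → G a b ≡ G b a) × (∀ a → G a a ≡ false)

_==_ : ∀ {N} → Fin N → Fin N → Bool
a == b = ⌊ a ≟ b ⌋

count : ∀ {A : Set} → (A → Bool) → List A → ℕ
count p [] = 0
count p (x ∷ xs) = (if p x then 1 else 0) + count p xs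

deg : ∀ {N} → Adj N → Fin N → ℕ
deg {N} G a = count (G a) (allFin N)

data Reach {N} (G : Adj N) : Fin N → Fin N → Set where
  here : ∀ {a} → Reach G a a
  step : ∀ {a b c} → G a b ≡ true → Reach G b c → Reach G a c

Connected : ∀ {N} → Adj N → Set
Connected {N} G = ∀ (a b : Fin N) → Reach G a b

pendants : ∀ {N} → Adj N → ℕ
pendants {N} G = count (λ a → ⌊ deg G a Data.Nat.≟ 1 ⌋) (allFin N)

cycPairs : ∀ {N} → List (Fin N) → List (Fin N × Fin N)
cycPairs [] = []
cycPairs (c ∷ cs) = zip (c ∷ cs) (cs ++ [ c ])

IsCycle : ∀ {N} → Adj N → List (Fin N) → Set
IsCycle G C = (3 ≤ length C) × Unique C × All (λ p → G (Data.Product.proj₁ p) (Data.Product.proj₂ p) ≡ true) (cycPairs C)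

CycEdge : ∀ {N} → List (Fin N) → Fin N → Fin N → Set
CycEdge C a b = ((a , b) ∈ cycPairs C) ⊎ ((b , a) ∈ cycPairs C)

-- G is a connected simple graph whose only cycle is C (cycles identified by edge set)
UnicyclicWith : ∀ {N} → Adj N → List (Fin N) → Set
UnicyclicWith {N} G C =
  Simple G × Connected G × IsCycle G C ×
  (∀ D → IsCycle G D → ∀ (a b : Fin N) → CycEdge D a b ⇔ CycEdge C a b)

InU : ∀ {N} → ℕ → Adj N → List (Fin N) → Set
InU k G C = UnicyclicWith G C × pendants G ≡ k

edges : ∀ {N} → Adj N → List (Fin N × Fin N)
edges {N} G = concatMap (λ i → concatMap (λ j →
  if G i j ∧ (toℕ i <ᵇ toℕ j) then [ (i , j) ] else []) (allFin N)) (allFin N)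

-- SO(G) = Σ_{ab∈E} √(radicands), radicand = d(a)^2 + d(b)^2
soRadicands : ∀ {N} → Adj N → List ℕ
soRadicands G = map (λ p → deg G (Data.Product.proj₁ p) ^ 2 + deg G (Data.Product.proj₂ p) ^ 2) (edges G)

-- Real-number comparison of sums of square roots, via rational witnesses:
-- Σ √xs < Σ √ys  iff there are rationals qᵢ ≥ √xᵢ and rᵢ ≤ √yᵢ (rᵢ ≥ 0) with Σ q < Σ r.
ℕ→ℚ : ℕ → Q.ℚ
ℕ→ℚ n = (+ n) Q./ 1

sumℚ : List Q.ℚ → Q.ℚ
sumℚ = foldr Q._+_ Q.0ℚ

SqrtSumLt : List ℕ → List ℕ → Set
SqrtSumLt xs ys = ∃[ qs ] ∃[ rs ]
  Pointwise (λ a q → (Q.0ℚ Q.≤ q) × (ℕ→ℚ a Q.≤ q Q.* q)) xs qs ×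
  Pointwise (λ b r → (Q.0ℚ Q.≤ r) × (r Q.* r Q.≤ ℕ→ℚ b)) ys rs ×
  (sumℚ qs Q.< sumℚ rs)

SOlt : ∀ {N} → Adj N → Adj N → Set
SOlt G H = SqrtSumLt (soRadicands G) (soRadicands H)

deleteEdge : ∀ {N} → Adj N → Fin N → Fin N → Adj N
deleteEdge G u w a b = G a b ∧ not ((a == u ∧ b == w) ∨ (a == w ∧ b == u))

transfer : ∀ {N} → Adj N → (Fin N → Bool) → Fin N → Fin N → Adj N
transfer G M s t a b =
  if (a == s ∧ M b) ∨ (b == s ∧ M a) then false
  else if (a == t ∧ M b) ∨ (b == t ∧ M a) then true
  else G a b

-- Both transformations move edges from one of u, v to the other, so SO(G*) − SO(G) only
-- involves edges at u and v.  By unicyclicity u and v have no common neighbour besides w, and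
-- by the hypothesis on T* the neighbours of v other than w have degree 1 or 2; hence the change
-- is a comparison of a few square roots in d(u), d(v) and the degrees of a few neighbours (the
-- unbounded degree of y in (b) is removed with √(p + q) ≤ √p + √q).  These comparisons are
-- certified with four-decimal bounds: the tangent-line estimate √(x² + y²) ≤ x + y²/(2x)
-- settles all large degrees and the remaining cases are evaluated.  Finally each edge weight is
-- rounded to precision 1/K with K a multiple of N² + 1, so that the rounding errors of the at
-- most N² edges stay below the certified gap.
module Submission where

open import Defs
open import Data.Nat hiding (_≟_)
open import Data.Nat.Properties hiding (_≟_)
open import Data.Nat.DivMod using (_/_; _%_; m≡m%n+[m/n]*n; m%n<n; m/n<m)
open import Data.Nat.ListAction using (sum)
open import Data.Nat.ListAction.Properties using (sum-++)
open import Data.Nat.Tactic.RingSolver using (solve-∀)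
open import Data.Bool using (Bool; true; false; if_then_else_; T; _∧_; not)
open import Data.Bool.Properties using (∧-assoc; ∧-zeroʳ; ∧-identityʳ; ∨-identityʳ; ∨-comm)
open import Data.Bool.ListAction using (all)
open import Data.Empty using (⊥; ⊥-elim)
open import Data.Fin using (Fin; zero; suc; toℕ; punchIn; _≟_)
open import Data.Fin.Properties using (punchInᵢ≢i; toℕ-injective)
import Data.Integer as ℤ
import Data.Integer.Properties as ℤ
open import Data.List using (List; []; _∷_; _++_; [_]; map; zip; upTo; tabulate; concatMap; allFin)
open import Data.List.Properties using (map-∘; map-++)
open import Data.List.Membership.Propositional using (_∈_; _∉_)
open import Data.List.Membership.Propositional.Properties using (∈-upTo⁺; ∈-++⁻)
open import Data.List.Relation.Binary.Pointwise using (Pointwise; []; _∷_)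
open import Data.List.Relation.Unary.All using (All; []; _∷_; lookup)
open import Data.List.Relation.Unary.All.Properties using (all⁺)
open import Data.List.Relation.Unary.AllPairs using ([]; _∷_)
open import Data.List.Relation.Unary.Any using (here; there)
open import Data.List.Relation.Unary.Unique.Propositional using (Unique)
open import Data.Product using (_×_; _,_; proj₁; proj₂; ∃)
open import Data.Rational as ℚ using (ℚ; 0ℚ; toℚᵘ; fromℚᵘ)
open import Data.Rational.Properties using (toℚᵘ-fromℚᵘ; toℚᵘ-homo-+; toℚᵘ-homo-*; toℚᵘ-cancel-≤; toℚᵘ-cancel-<)
open import Data.Rational.Unnormalised as ℚᵘ using (ℚᵘ; *≤*; *<*; *≡*)
import Data.Rational.Unnormalised.Properties as ℚᵘ
open import Data.Sum using (inj₁; inj₂)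
open import Data.Unit using (tt)
open import Function using (_∘_; _$_; id)
open import Function.Bundles using (Equivalence)
open import Relation.Nullary using (Dec; yes; no; ofʸ; ofⁿ; contradiction)
open import Relation.Nullary.Decidable using (isYes≗does; dec-true; dec-false)
open import Relation.Binary.PropositionalEquality hiding ([_])
open import Algebra.Properties.Semiring.Sum +-*-semiring
  using (∑-distrib-+; ∑-comm; sum-cong-≗; sum-remove; *-distribʳ-sum) renaming (sum to ∑)

private
  variable
    n : ℕ

  true≢false : true ≢ false
  true≢false ()

-- Integer square roots

IsFloorSqrt : ℕ → ℕ → Set
IsFloorSqrt n r = r * r ≤ n × n < suc r * suc r

⌊√⌋-step : ℕ → ℕ → ℕ
⌊√⌋-step n r = if suc r * suc r ≤ᵇ n then suc r else r

-- Base-4 digit recursion; the fuel only guarantees termination.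
⌊√⌋-fuel : ℕ → ℕ → ℕ
⌊√⌋-fuel zero    _       = 0
⌊√⌋-fuel (suc k) zero    = 0
⌊√⌋-fuel (suc k) (suc n) = ⌊√⌋-step (suc n) (2 * ⌊√⌋-fuel k (suc n / 4))

⌊√⌋-step-correct : ∀ n r → r * r ≤ n → n < suc (suc r) * suc (suc r) → IsFloorSqrt n (⌊√⌋-step n r)
⌊√⌋-step-correct n r r²≤n n<[r+2]² with suc r * suc r ≤ᵇ n | ≤ᵇ-reflects-≤ (suc r * suc r) n
... | true  | ofʸ [r+1]²≤n = [r+1]²≤n , n<[r+2]²
... | false | ofⁿ [r+1]²≰n = r²≤n , ≰⇒> [r+1]²≰n

⌊√⌋-fuel-correct : ∀ k n → n ≤ k → IsFloorSqrt n (⌊√⌋-fuel k n)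
⌊√⌋-fuel-correct zero    zero    _   = z≤n , s≤s z≤n
⌊√⌋-fuel-correct (suc k) zero    _   = z≤n , s≤s z≤n
⌊√⌋-fuel-correct (suc k) (suc n) n+1≤k+1 = ⌊√⌋-step-correct (suc n) (2 * r) lower upper
  where
  open ≤-Reasoning
  q = suc n / 4
  r = ⌊√⌋-fuel k q
  IH : IsFloorSqrt q r
  IH = ⌊√⌋-fuel-correct k q (≤-pred (<-≤-trans (m/n<m (suc n) 4 (s≤s (s≤s z≤n))) n+1≤k+1))
  n≡ : suc n ≡ suc n % 4 + q * 4
  n≡ = m≡m%n+[m/n]*n (suc n) 4
  double-square : ∀ r → 2 * r * (2 * r) ≡ r * r * 4
  double-square = solve-∀
  double-suc-square : ∀ r → suc (suc (2 * r)) * suc (suc (2 * r)) ≡ suc r * suc r * 4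
  double-suc-square = solve-∀
  lower : 2 * r * (2 * r) ≤ suc n
  lower = begin
    2 * r * (2 * r)   ≡⟨ double-square r ⟩
    r * r * 4         ≤⟨ *-monoˡ-≤ 4 (proj₁ IH) ⟩
    q * 4             ≤⟨ m≤n+m (q * 4) (suc n % 4) ⟩
    suc n % 4 + q * 4 ≡⟨ n≡ ⟨
    suc n             ∎
  upper : suc n < suc (suc (2 * r)) * suc (suc (2 * r))
  upper = begin-strict
    suc n                                 ≡⟨ n≡ ⟩
    suc n % 4 + q * 4                     <⟨ +-monoˡ-< (q * 4) (m%n<n (suc n) 4) ⟩
    suc q * 4                             ≤⟨ *-monoˡ-≤ 4 (proj₂ IH) ⟩
    suc r * suc r * 4                     ≡⟨ double-suc-square r ⟨
    suc (suc (2 * r)) * suc (suc (2 * r)) ∎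

-- Opaque: unfolding it on symbolic arguments is prohibitively slow; closed values are computed
-- in `unfolding` blocks.
opaque
  ⌊√_⌋ : ℕ → ℕ
  ⌊√ n ⌋ = ⌊√⌋-fuel n n

  ⌊_√_⌋ : ℕ → ℕ → ℕ
  ⌊ K √ R ⌋ = ⌊√ K * K * R ⌋

  ⌊√⌋-correct : ∀ K R → IsFloorSqrt (K * K * R) ⌊ K √ R ⌋
  ⌊√⌋-correct K R = ⌊√⌋-fuel-correct (K * K * R) (K * K * R) ≤-refl

⌊√⌋-greatest : ∀ K R {r} → r * r ≤ K * K * R → r ≤ ⌊ K √ R ⌋
⌊√⌋-greatest K R r²≤n = ≮⇒≥ λ √n<r →
  <⇒≱ (proj₂ (⌊√⌋-correct K R)) (≤-trans (*-mono-≤ √n<r √n<r) r²≤n)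

⌊√⌋-least : ∀ K R {r} → K * K * R < r * r → ⌊ K √ R ⌋ < r
⌊√⌋-least K R n<r² = ≰⇒> λ r≤√n →
  <⇒≱ n<r² (≤-trans (*-mono-≤ r≤√n r≤√n) (proj₁ (⌊√⌋-correct K R)))

⌊√⌋-mono-≤ : ∀ K {R R′} → R ≤ R′ → ⌊ K √ R ⌋ ≤ ⌊ K √ R′ ⌋
⌊√⌋-mono-≤ K {R} {R′} R≤R′ = ⌊√⌋-greatest K R′ (≤-trans (proj₁ (⌊√⌋-correct K R)) (*-monoʳ-≤ (K * K) R≤R′))

⌊√⌋-subadditive : ∀ K P Q → ⌊ K √ P + Q ⌋ < suc ⌊ K √ P ⌋ + suc ⌊ K √ Q ⌋
⌊√⌋-subadditive K P Q = ⌊√⌋-least K (P + Q) (begin-strict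
  K * K * (P + Q)             ≡⟨ *-distribˡ-+ (K * K) P Q ⟩
  K * K * P + K * K * Q       <⟨ +-mono-< (proj₂ (⌊√⌋-correct K P)) (proj₂ (⌊√⌋-correct K Q)) ⟩
  a * a + b * b               ≤⟨ m≤m+n (a * a + b * b) (2 * (a * b)) ⟩
  a * a + b * b + 2 * (a * b) ≡⟨ square-sum a b ⟩
  (a + b) * (a + b)           ∎)
  where
  open ≤-Reasoning
  a = suc ⌊ K √ P ⌋
  b = suc ⌊ K √ Q ⌋
  square-sum : ∀ a b → a * a + b * b + 2 * (a * b) ≡ (a + b) * (a + b)
  square-sum = solve-∀

private
  square-of-product : ∀ a s → a * s * (a * s) ≡ a * a * (s * s)
  square-of-product = solve-∀

  square-of-scale : ∀ a K R → a * a * (K * K * R) ≡ a * K * (a * K) * R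
  square-of-scale = solve-∀

⌊√⌋-scale-lower : ∀ a K R → a * ⌊ K √ R ⌋ ≤ ⌊ a * K √ R ⌋
⌊√⌋-scale-lower a K R = ⌊√⌋-greatest (a * K) R (begin
  a * s * (a * s)     ≡⟨ square-of-product a s ⟩
  a * a * (s * s)     ≤⟨ *-monoʳ-≤ (a * a) (proj₁ (⌊√⌋-correct K R)) ⟩
  a * a * (K * K * R) ≡⟨ square-of-scale a K R ⟩
  a * K * (a * K) * R ∎)
  where
  open ≤-Reasoning
  s = ⌊ K √ R ⌋

⌊√⌋-scale-upper : ∀ a .{{_ : NonZero a}} K R → ⌊ a * K √ R ⌋ < a * suc ⌊ K √ R ⌋
⌊√⌋-scale-upper a K R = ⌊√⌋-least (a * K) R (begin-strict
  a * K * (a * K) * R     ≡⟨ square-of-scale a K R ⟨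
  a * a * (K * K * R)     <⟨ *-monoʳ-< (a * a) {{m*n≢0 a a}} (proj₂ (⌊√⌋-correct K R)) ⟩
  a * a * (suc s * suc s) ≡⟨ square-of-product a (suc s) ⟨
  a * suc s * (a * suc s) ∎)
  where
  open ≤-Reasoning
  s = ⌊ K √ R ⌋

rad : ℕ → ℕ → ℕ
rad x y = x * x + y * y

private
  expand-rad : ∀ K x y → K * x * (K * x) + K * (K * (y * y)) ≡ K * K * (x * x + y * y)
  expand-rad = solve-∀

⌊√⌋-rad-lower : ∀ K x y → K * x ≤ ⌊ K √ rad x y ⌋
⌊√⌋-rad-lower K x y = ⌊√⌋-greatest K (rad x y) (begin
  K * x * (K * x)                     ≤⟨ m≤m+n _ (K * (K * (y * y))) ⟩
  K * x * (K * x) + K * (K * (y * y)) ≡⟨ expand-rad K x y ⟩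
  K * K * rad x y                     ∎)
  where open ≤-Reasoning

⌊√⌋-rad-upper : ∀ K x₀ x y p .{{_ : NonZero p}} → K * (y * y) ≤ 2 * x₀ * p → x₀ ≤ x →
                ⌊ K √ rad x y ⌋ < K * x + p
⌊√⌋-rad-upper K x₀ x y p@(suc _) Ky²≤2x₀p x₀≤x = ⌊√⌋-least K (rad x y) (begin-strict
  K * K * rad x y                           ≡⟨ expand-rad K x y ⟨
  K * x * (K * x) + K * (K * (y * y))       ≤⟨ +-monoʳ-≤ (K * x * (K * x)) (*-monoʳ-≤ K Ky²≤2xp) ⟩
  K * x * (K * x) + K * (2 * x * p)         <⟨ m<m+n _ (s≤s z≤n) ⟩
  K * x * (K * x) + K * (2 * x * p) + p * p ≡⟨ square K x p ⟩
  (K * x + p) * (K * x + p)                 ∎)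
  where
  open ≤-Reasoning
  Ky²≤2xp : K * (y * y) ≤ 2 * x * p
  Ky²≤2xp = ≤-trans Ky²≤2x₀p (*-monoˡ-≤ p (*-monoʳ-≤ 2 x₀≤x))
  square : ∀ K x p → K * x * (K * x) + K * (2 * x * p) + p * p ≡ (K * x + p) * (K * x + p)
  square = solve-∀

⌊√⌋-below-square : ∀ K .{{_ : NonZero K}} R x → R < x * x → ⌊ K √ R ⌋ < K * x
⌊√⌋-below-square K R x R<x² = ⌊√⌋-least K R (begin-strict
  K * K * R       <⟨ *-monoʳ-< (K * K) {{m*n≢0 K K}} R<x² ⟩
  K * K * (x * x) ≡⟨ square-of-product K x ⟨
  K * x * (K * x) ∎)
  where open ≤-Reasoning

-- Certified comparison of sums of square roots

private
  pos-*-≤ : ∀ a b c d → a * b ≤ c * d → ℤ.+ a ℤ.* ℤ.+ b ℤ.≤ ℤ.+ c ℤ.* ℤ.+ d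
  pos-*-≤ a b c d le = subst₂ ℤ._≤_ (ℤ.pos-* a b) (ℤ.pos-* c d) (ℤ.+≤+ le)

  pos-*-< : ∀ a b c d → a * b < c * d → ℤ.+ a ℤ.* ℤ.+ b ℤ.< ℤ.+ c ℤ.* ℤ.+ d
  pos-*-< a b c d lt = subst₂ ℤ._<_ (ℤ.pos-* a b) (ℤ.pos-* c d) (ℤ.+<+ lt)

  pointwise-map : ∀ {A B : Set} {P : A → B → Set} (f : A → B) xs → (∀ x → P x (f x)) → Pointwise P xs (map f xs)
  pointwise-map f []       _   = []
  pointwise-map f (x ∷ xs) Pfx = Pfx x ∷ pointwise-map f xs Pfx

private module Floors (k : ℕ) where

  K : ℕ
  K = suc k

  frac : ℕ → ℚᵘ
  frac n = ℤ.+ n ℚᵘ./ K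

  _/K : ℕ → ℚ
  n /K = fromℚᵘ (frac n)

  toℚᵘ-/K : ∀ n → toℚᵘ (n /K) ℚᵘ.≃ frac n
  toℚᵘ-/K n = toℚᵘ-fromℚᵘ (frac n)

  toℚᵘ-square : ∀ n → toℚᵘ (n /K ℚ.* n /K) ℚᵘ.≃ frac n ℚᵘ.* frac n
  toℚᵘ-square n = ℚᵘ.≃-trans (toℚᵘ-homo-* (n /K) (n /K)) (ℚᵘ.*-cong (toℚᵘ-/K n) (toℚᵘ-/K n))

  /K-nonNegative : ∀ n → 0ℚ ℚ.≤ n /K
  /K-nonNegative n = toℚᵘ-cancel-≤ (ℚᵘ.≤-respʳ-≃ (ℚᵘ.≃-sym (toℚᵘ-/K n)) (*≤* (pos-*-≤ 0 K n 1 z≤n)))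

  /K-square-above : ∀ R n → K * K * R ≤ n * n → ℕ→ℚ R ℚ.≤ n /K ℚ.* n /K
  /K-square-above R n le = toℚᵘ-cancel-≤ (ℚᵘ.≤-respˡ-≃ (ℚᵘ.≃-sym (toℚᵘ-fromℚᵘ (ℤ.+ R ℚᵘ./ 1)))
    (ℚᵘ.≤-respʳ-≃ (ℚᵘ.≃-sym (toℚᵘ-square n)) (*≤* (subst (λ z → ℤ.+ R ℤ.* ℤ.+ (K * K) ℤ.≤ z ℤ.* ℤ.+ 1) (ℤ.pos-* n n)
      (pos-*-≤ R (K * K) (n * n) 1 (subst₂ _≤_ (*-comm (K * K) R) (sym (*-identityʳ (n * n))) le))))))

  /K-square-below : ∀ R n → n * n ≤ K * K * R → n /K ℚ.* n /K ℚ.≤ ℕ→ℚ R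
  /K-square-below R n le = toℚᵘ-cancel-≤ (ℚᵘ.≤-respʳ-≃ (ℚᵘ.≃-sym (toℚᵘ-fromℚᵘ (ℤ.+ R ℚᵘ./ 1)))
    (ℚᵘ.≤-respˡ-≃ (ℚᵘ.≃-sym (toℚᵘ-square n)) (*≤* (subst (λ z → z ℤ.* ℤ.+ 1 ℤ.≤ ℤ.+ R ℤ.* ℤ.+ (K * K)) (ℤ.pos-* n n)
      (pos-*-≤ (n * n) 1 R (K * K) (subst₂ _≤_ (sym (*-identityʳ (n * n))) (*-comm (K * K) R) le))))))

  frac-+ : ∀ a b → frac a ℚᵘ.+ frac b ℚᵘ.≃ frac (a + b)
  frac-+ a b = *≡* (begin
    (ℤ.+ a ℤ.* ℤ.+ K ℤ.+ ℤ.+ b ℤ.* ℤ.+ K) ℤ.* ℤ.+ K ≡⟨ cong (ℤ._* ℤ.+ K) (cong₂ ℤ._+_ (ℤ.pos-* a K) (ℤ.pos-* b K)) ⟨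
    (ℤ.+ (a * K) ℤ.+ ℤ.+ (b * K)) ℤ.* ℤ.+ K     ≡⟨ cong (ℤ._* ℤ.+ K) (ℤ.pos-+ (a * K) (b * K)) ⟨
    ℤ.+ (a * K + b * K) ℤ.* ℤ.+ K               ≡⟨ ℤ.pos-* (a * K + b * K) K ⟨
    ℤ.+ ((a * K + b * K) * K)                   ≡⟨ cong ℤ.+_ (rearrange a b K) ⟩
    ℤ.+ ((a + b) * (K * K))                     ≡⟨ ℤ.pos-* (a + b) (K * K) ⟩
    ℤ.+ (a + b) ℤ.* ℤ.+ (K * K)                 ∎)
    where
    open ≡-Reasoning
    rearrange : ∀ a b K → (a * K + b * K) * K ≡ (a + b) * (K * K)
    rearrange = solve-∀

  toℚᵘ-sum : ∀ ns → toℚᵘ (sumℚ (map _/K ns)) ℚᵘ.≃ frac (sum ns)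
  toℚᵘ-sum []       = *≡* refl
  toℚᵘ-sum (n ∷ ns) = ℚᵘ.≃-trans (toℚᵘ-homo-+ (n /K) (sumℚ (map _/K ns)))
    (ℚᵘ.≃-trans (ℚᵘ.+-cong (toℚᵘ-/K n) (toℚᵘ-sum ns)) (frac-+ n (sum ns)))

  sum-/K-< : ∀ ms ns → sum ms < sum ns → sumℚ (map _/K ms) ℚ.< sumℚ (map _/K ns)
  sum-/K-< ms ns lt = toℚᵘ-cancel-< (ℚᵘ.<-respˡ-≃ (ℚᵘ.≃-sym (toℚᵘ-sum ms)) (ℚᵘ.<-respʳ-≃ (ℚᵘ.≃-sym (toℚᵘ-sum ns))
    (*<* (pos-*-< (sum ms) K (sum ns) K (*-monoˡ-< K lt)))))

  certify : ∀ xs ys → sum (map (suc ∘ ⌊ K √_⌋) xs) < sum (map ⌊ K √_⌋ ys) → SqrtSumLt xs ys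
  certify xs ys lt = map (_/K ∘ suc ∘ ⌊ K √_⌋) xs , map (_/K ∘ ⌊ K √_⌋) ys , above , below , sums
    where
    above = pointwise-map _ xs λ R →
      /K-nonNegative (suc ⌊ K √ R ⌋) , /K-square-above R (suc ⌊ K √ R ⌋) (<⇒≤ (proj₂ (⌊√⌋-correct K R)))
    below = pointwise-map _ ys λ R →
      /K-nonNegative ⌊ K √ R ⌋ , /K-square-below R ⌊ K √ R ⌋ (proj₁ (⌊√⌋-correct K R))
    sums = subst₂ ℚ._<_ (cong sumℚ (sym (map-∘ {g = _/K} xs))) (cong sumℚ (sym (map-∘ {g = _/K} ys)))
      (sum-/K-< (map (suc ∘ ⌊ K √_⌋) xs) (map ⌊ K √_⌋ ys) lt)

SqrtSumLt-by-floors : ∀ K .{{_ : NonZero K}} xs ys → sum (map (suc ∘ ⌊ K √_⌋) xs) < sum (map ⌊ K √_⌋ ys) →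
                      SqrtSumLt xs ys
SqrtSumLt-by-floors zero    = contradiction refl (≢-nonZero⁻¹ 0)
SqrtSumLt-by-floors (suc k) = Floors.certify k

sum-map-≤-* : ∀ {A : Set} {f g : A → ℕ} a xs → (∀ x → f x ≤ a * g x) → sum (map f xs) ≤ a * sum (map g xs)
sum-map-≤-* a []       _      = z≤n
sum-map-≤-* {f = f} {g} a (x ∷ xs) f≤ag = begin
  f x + sum (map f xs)         ≤⟨ +-mono-≤ (f≤ag x) (sum-map-≤-* a xs f≤ag) ⟩
  a * g x + a * sum (map g xs) ≡⟨ *-distribˡ-+ a (g x) _ ⟨
  a * (g x + sum (map g xs))   ∎
  where open ≤-Reasoning

sum-map-*-≤ : ∀ {A : Set} {f g : A → ℕ} a xs → (∀ x → a * g x ≤ f x) → a * sum (map g xs) ≤ sum (map f xs)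
sum-map-*-≤ a []       _      = ≤-reflexive (*-zeroʳ a)
sum-map-*-≤ {f = f} {g} a (x ∷ xs) ag≤f = begin
  a * (g x + sum (map g xs))   ≡⟨ *-distribˡ-+ a (g x) _ ⟩
  a * g x + a * sum (map g xs) ≤⟨ +-mono-≤ (ag≤f x) (sum-map-*-≤ a xs ag≤f) ⟩
  f x + sum (map f xs)         ∎
  where open ≤-Reasoning

sum-map-bounded-above : ∀ {A : Set} {f : A → ℕ} {xs us} → Pointwise (λ x u → f x ≤ u) xs us → sum (map f xs) ≤ sum us
sum-map-bounded-above []           = z≤n
sum-map-bounded-above (fx≤u ∷ fxs≤us) = +-mono-≤ fx≤u (sum-map-bounded-above fxs≤us)

sum-map-bounded-below : ∀ {A : Set} {f : A → ℕ} {ys ls} → Pointwise (λ y l → l ≤ f y) ys ls → sum ls ≤ sum (map f ys)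
sum-map-bounded-below []           = z≤n
sum-map-bounded-below (l≤fy ∷ ls≤fys) = +-mono-≤ l≤fy (sum-map-bounded-below ls≤fys)

-- SqrtGap K xs e ys f certifies K · Σ √xs + e ≤ K · Σ √ys + f.
record SqrtGap (K : ℕ) (xs : List ℕ) (e : ℕ) (ys : List ℕ) (f : ℕ) : Set where
  constructor sqrtGap
  field
    certified : sum (map (suc ∘ ⌊ K √_⌋) xs) + e ≤ sum (map ⌊ K √_⌋ ys) + f

sqrtGap? : ℕ → List ℕ → ℕ → List ℕ → ℕ → Bool
sqrtGap? K xs e ys f = sum (map (suc ∘ ⌊ K √_⌋) xs) + e ≤ᵇ sum (map ⌊ K √_⌋ ys) + f

SqrtGap-by-evaluation : ∀ {K xs e ys f} → T (sqrtGap? K xs e ys f) → SqrtGap K xs e ys f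
SqrtGap-by-evaluation ok = sqrtGap (≤ᵇ⇒≤ _ _ ok)

SqrtGap-by-bounds : ∀ {K xs e ys f us ls} →
  Pointwise (λ x u → ⌊ K √ x ⌋ < u) xs us → Pointwise (λ y l → l ≤ ⌊ K √ y ⌋) ys ls →
  sum us + e ≤ sum ls + f → SqrtGap K xs e ys f
SqrtGap-by-bounds {e = e} {f = f} upper lower us+e≤ls+f = sqrtGap $
  ≤-trans (+-monoˡ-≤ e (sum-map-bounded-above upper)) (≤-trans us+e≤ls+f (+-monoˡ-≤ f (sum-map-bounded-below lower)))

SqrtGap-scale : ∀ a .{{_ : NonZero a}} K xs e ys f → SqrtGap K xs e ys f →
  sum (map ⌊ a * K √_⌋ xs) + a * e ≤ sum (map ⌊ a * K √_⌋ ys) + a * f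
SqrtGap-scale a K xs e ys f (sqrtGap gap) = begin
  sum (map ⌊ a * K √_⌋ xs) + a * e         ≤⟨ +-monoˡ-≤ (a * e) (sum-map-≤-* a xs (λ R → <⇒≤ (⌊√⌋-scale-upper a K R))) ⟩
  a * sum (map (suc ∘ ⌊ K √_⌋) xs) + a * e ≡⟨ *-distribˡ-+ a _ e ⟨
  a * (sum (map (suc ∘ ⌊ K √_⌋) xs) + e)   ≤⟨ *-monoʳ-≤ a gap ⟩
  a * (sum (map ⌊ K √_⌋ ys) + f)           ≡⟨ *-distribˡ-+ a _ f ⟩
  a * sum (map ⌊ K √_⌋ ys) + a * f         ≤⟨ +-monoˡ-≤ (a * f) (sum-map-*-≤ a ys (⌊√⌋-scale-lower a K)) ⟩
  sum (map ⌊ a * K √_⌋ ys) + a * f         ∎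
  where open ≤-Reasoning

-- Four-decimal estimates

private
  evaluated : ∀ {m n} → T (m ≤ᵇ n) → m ≤ n
  evaluated = ≤ᵇ⇒≤ _ _

  ≤-by-common-part : ∀ {x y a b v s} → x ≡ a + v → y ≡ b + v + s → a ≤ b → x ≤ y
  ≤-by-common-part {v = v} {s} refl refl a≤b = ≤-trans (+-monoˡ-≤ v a≤b) (m≤m+n _ s)

  checked-below : ∀ (p : ℕ → Bool) n {i} → T (all p (upTo n)) → i < n → T (p i)
  checked-below p n ok i<n = lookup (all⁺ p (upTo n) ok) (∈-upTo⁺ i<n)

  checked-below⁴ : ∀ (p : ℕ → ℕ → ℕ → ℕ → Bool) a b c d →
    T (all (λ i → all (λ j → all (λ k → all (p i j k) (upTo d)) (upTo c)) (upTo b)) (upTo a)) →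
    ∀ {i j k l} → i < a → j < b → k < c → l < d → T (p i j k l)
  checked-below⁴ p a b c d ok {i} {j} {k} i<a j<b k<c l<d =
    checked-below (p i j k) d (checked-below (λ k → all (p i j k) (upTo d)) c
      (checked-below (λ j → all (λ k → all (p i j k) (upTo d)) (upTo c)) b
        (checked-below (λ i → all (λ j → all (λ k → all (p i j k) (upTo d)) (upTo c)) (upTo b)) a ok i<a) j<b) k<c) l<d

  one-or-two : ∀ {P : ℕ → Set} → P 1 → P 2 → ∀ d → 1 ≤ d → d ≤ 2 → P d
  one-or-two P1 P2 1 _ _ = P1
  one-or-two P1 P2 2 _ _ = P2
  one-or-two P1 P2 (suc (suc (suc _))) _ (s≤s (s≤s ()))

  4m+m²<[2+m]² : ∀ m → 4 * m + m * m < (2 + m) * (2 + m)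
  4m+m²<[2+m]² m = subst (4 * m + m * m <_) (expand m) (m<n+m (4 * m + m * m) {4} (s≤s z≤n))
    where
    expand : ∀ m → 4 + (4 * m + m * m) ≡ (2 + m) * (2 + m)
    expand = solve-∀

  tangent-upper : ∀ x₀ p .{{_ : NonZero p}} x y → T (10000 * 4 ≤ᵇ 2 * x₀ * p) → x₀ ≤ x → y ≤ 2 →
          ⌊ 10000 √ rad x y ⌋ < 10000 * x + p
  tangent-upper x₀ p x y check x₀≤x y≤2 =
    ⌊√⌋-rad-upper 10000 x₀ x y p (≤-trans (*-monoʳ-≤ 10000 (*-mono-≤ y≤2 y≤2)) (evaluated check)) x₀≤x

  leading-lower : ∀ x y → 10000 * x ≤ ⌊ 10000 √ rad x y ⌋
  leading-lower = ⌊√⌋-rad-lower 10000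

  opaque
    unfolding ⌊_√_⌋

    √5-lower : 22360 ≤ ⌊ 10000 √ rad 2 1 ⌋
    √5-lower = evaluated tt

    √5-upper : ⌊ 10000 √ 4 * 1 + 1 * 1 ⌋ < 22361
    √5-upper = evaluated tt

    √8-lower : 28284 ≤ ⌊ 10000 √ rad 2 2 ⌋
    √8-lower = evaluated tt

    √13-upper : ⌊ 10000 √ rad 3 2 ⌋ < 36056
    √13-upper = evaluated tt

  √[4+d²]-lower : ∀ d → 1 ≤ d → 22360 ≤ ⌊ 10000 √ rad 2 d ⌋
  √[4+d²]-lower d 1≤d = ≤-trans √5-lower (⌊√⌋-mono-≤ 10000 (+-monoʳ-≤ 4 (*-mono-≤ 1≤d 1≤d)))

-- Radicands of the edges vw, uw, vv₁ and vv₂ (v₂ a moved neighbour) before and after the move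
-- of part (a), where d(v) = 2 + m, d(u) = 2 + m + t and dᵢ = d(vᵢ).
gapA-left gapA-right : ℕ → ℕ → ℕ → ℕ → List ℕ
gapA-left  m t d₁ d₂ = rad (2 + m) 2 ∷ rad (2 + m + t) 2 ∷ rad (2 + m) d₁ ∷ rad (2 + m) d₂ ∷ []
gapA-right m t d₁ d₂ = rad 2 2 ∷ rad (2 + m + t + m) 2 ∷ rad 2 d₁ ∷ rad (2 + m + t + m) d₂ ∷ []

GapA : ℕ → ℕ → ℕ → ℕ → Set
GapA m t d₁ d₂ = SqrtGap 10000 (gapA-left m t d₁ d₂) 1 (gapA-right m t d₁ d₂) 0

-- With the tangent-line bounds the comparison becomes linear in the degrees; it is split into
-- a polynomial identity in the scale W and a numerical inequality at W = 10⁴.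
gapA-t≥2 : ∀ z t {d₁ d₂} → 1 ≤ d₁ → d₁ ≤ 2 → d₂ ≤ 2 → GapA (suc z) (2 + t) d₁ d₂
gapA-t≥2 z t {d₁} {d₂} 1≤d₁ d₁≤2 d₂≤2 = SqrtGap-by-bounds
  (tangent-upper 3 6667 b 2 tt 3≤b ≤-refl ∷ tangent-upper 3 6667 a 2 tt (m≤m+n 3 _) ≤-refl ∷
   tangent-upper 3 6667 b d₁ tt 3≤b d₁≤2 ∷ tangent-upper 3 6667 b d₂ tt 3≤b d₂≤2 ∷ [])
  (√8-lower ∷ leading-lower A 2 ∷ √[4+d²]-lower d₁ 1≤d₁ ∷ leading-lower A d₂ ∷ [])
  (linear 10000 6667 28284 22360 (evaluated tt))
  where
  b = 2 + suc z
  a = b + (2 + t)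
  A = a + suc z
  3≤b : 3 ≤ b
  3≤b = m≤m+n 3 z
  linear : ∀ W p q r → p + p + p + p + 1 + 2 * W ≤ q + r →
    sum (W * b + p ∷ W * a + p ∷ W * b + p ∷ W * b + p ∷ []) + 1 ≤ sum (q ∷ W * A ∷ r ∷ W * A ∷ []) + 0
  linear W p q r = ≤-by-common-part (lhs W p z t) (rhs W q r z t)
    where
    lhs : ∀ W p z t →
      W * (2 + suc z) + p + (W * (2 + suc z + (2 + t)) + p + (W * (2 + suc z) + p + (W * (2 + suc z) + p + 0))) + 1
        ≡ p + p + p + p + 1 + 2 * W + W * (12 + 4 * z + t)
    lhs = solve-∀
    rhs : ∀ W q r z t →
      q + (W * (2 + suc z + (2 + t) + suc z) + (r + (W * (2 + suc z + (2 + t) + suc z) + 0))) + 0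
        ≡ q + r + W * (12 + 4 * z + t) + W * t
    rhs = solve-∀

gapA-m≥6 : ∀ z t {d₁ d₂} → 1 ≤ d₁ → d₁ ≤ 2 → d₂ ≤ 2 → GapA (6 + z) t d₁ d₂
gapA-m≥6 z t {d₁} {d₂} 1≤d₁ d₁≤2 d₂≤2 = SqrtGap-by-bounds
  (tangent-upper 8 2500 b 2 tt 8≤b ≤-refl ∷ tangent-upper 8 2500 a 2 tt (m≤m+n 8 _) ≤-refl ∷
   tangent-upper 8 2500 b d₁ tt 8≤b d₁≤2 ∷ tangent-upper 8 2500 b d₂ tt 8≤b d₂≤2 ∷ [])
  (√8-lower ∷ leading-lower A 2 ∷ √[4+d²]-lower d₁ 1≤d₁ ∷ leading-lower A d₂ ∷ [])
  (linear 10000 2500 28284 22360 (evaluated tt))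
  where
  b = 2 + (6 + z)
  a = b + t
  A = a + (6 + z)
  8≤b : 8 ≤ b
  8≤b = m≤m+n 8 z
  linear : ∀ W p q r → p + p + p + p + 1 + 4 * W ≤ q + r →
    sum (W * b + p ∷ W * a + p ∷ W * b + p ∷ W * b + p ∷ []) + 1 ≤ sum (q ∷ W * A ∷ r ∷ W * A ∷ []) + 0
  linear W p q r = ≤-by-common-part (lhs W p z t) (rhs W q r z t)
    where
    lhs : ∀ W p z t →
      W * (2 + (6 + z)) + p + (W * (2 + (6 + z) + t) + p + (W * (2 + (6 + z)) + p + (W * (2 + (6 + z)) + p + 0))) + 1
        ≡ p + p + p + p + 1 + 4 * W + W * (28 + 4 * z + t)
    lhs = solve-∀
    rhs : ∀ W q r z t →
      q + (W * (2 + (6 + z) + t + (6 + z)) + (r + (W * (2 + (6 + z) + t + (6 + z)) + 0))) + 0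
        ≡ q + r + W * (28 + 4 * z + t) + W * t
    rhs = solve-∀

gapA? : ℕ → ℕ → ℕ → ℕ → Bool
gapA? z t e₁ e₂ = sqrtGap? 10000 (gapA-left (suc z) t (suc e₁) (suc e₂)) 1 (gapA-right (suc z) t (suc e₁) (suc e₂)) 0

opaque
  unfolding ⌊_√_⌋
  gapA-small-cases : T (all (λ z → all (λ t → all (λ e₁ → all (gapA? z t e₁) (upTo 2)) (upTo 2)) (upTo 2)) (upTo 5))
  gapA-small-cases = tt

gapA-small : ∀ z t e₁ e₂ → z < 5 → t < 2 → e₁ < 2 → e₂ < 2 → GapA (suc z) t (suc e₁) (suc e₂)
gapA-small z t e₁ e₂ z<5 t<2 e₁<2 e₂<2 =
  SqrtGap-by-evaluation (checked-below⁴ gapA? 5 2 2 2 gapA-small-cases z<5 t<2 e₁<2 e₂<2)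

gapA : ∀ m a d₁ d₂ → 1 ≤ m → 2 + m ≤ a → 1 ≤ d₁ → d₁ ≤ 2 → 1 ≤ d₂ → d₂ ≤ 2 →
  SqrtGap 10000 (rad (2 + m) 2 ∷ rad a 2 ∷ rad (2 + m) d₁ ∷ rad (2 + m) d₂ ∷ []) 1
                (rad 2 2 ∷ rad (a + m) 2 ∷ rad 2 d₁ ∷ rad (a + m) d₂ ∷ []) 0
gapA (suc z) a d₁ d₂ _ b≤a 1≤d₁ d₁≤2 1≤d₂ d₂≤2 with m≤n⇒∃[o]m+o≡n b≤a
... | t , refl with 2 ≤? t | 5 ≤? z
...   | yes 2≤t | _ with m≤n⇒∃[o]m+o≡n 2≤t
...     | t′ , refl = gapA-t≥2 z t′ 1≤d₁ d₁≤2 d₂≤2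
gapA (suc z) a d₁ d₂ _ b≤a 1≤d₁ d₁≤2 1≤d₂ d₂≤2 | t , refl | no _ | yes 5≤z with m≤n⇒∃[o]m+o≡n 5≤z
...     | z′ , refl = gapA-m≥6 z′ t 1≤d₁ d₁≤2 d₂≤2
gapA (suc z) a (suc e₁) (suc e₂) _ b≤a _ e₁<2 _ e₂<2 | t , refl | no t≱2 | no z≱5 =
  gapA-small z t e₁ e₂ (≰⇒> z≱5) (≰⇒> t≱2) e₁<2 e₂<2

-- Part (b) with d(u) = 2 + m and d(v) = 1 + c: γ / 10⁴ bounds from below the gain of each of the
-- c edges from v to a neighbour other than w, and √(4m + m²) bounds the loss on the edge uy,
-- since (2 + m)² + d(y)² = 2² + d(y)² + (4m + m²).
EdgeGapB : ℕ → ℕ → ℕ → Set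
EdgeGapB m c γ = ∀ d → 1 ≤ d → d ≤ 2 → SqrtGap 10000 (rad (1 + c) d ∷ []) γ (rad (1 + c + m) d ∷ []) 0

MainGapB : ℕ → ℕ → ℕ → Set
MainGapB m c γ =
  SqrtGap 10000 (4 * m + m * m ∷ rad (2 + m) 2 ∷ rad (1 + c) 2 ∷ []) 2 (rad 2 2 ∷ rad (1 + c + m) 2 ∷ []) (γ * c)

gapB-m≡1 : ∀ t → let c = 3 + suc (suc t) in EdgeGapB 1 c 6666 × MainGapB 1 c 6666
gapB-m≡1 t = edge , main
  where
  c = 3 + suc (suc t)
  X = 1 + c
  6≤X : 6 ≤ X
  6≤X = m≤m+n 6 t
  edge : EdgeGapB 1 c 6666
  edge d _ d≤2 = SqrtGap-by-bounds (tangent-upper 6 3334 X d tt 6≤X d≤2 ∷ []) (leading-lower (X + 1) d ∷ [])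
    (linear 10000 3334 6666 (evaluated tt))
    where
    linear : ∀ W p γ → p + γ ≤ W → sum (W * X + p ∷ []) + γ ≤ sum (W * (X + 1) ∷ []) + 0
    linear W p γ = ≤-by-common-part (lhs W p γ t) (rhs W t)
      where
      lhs : ∀ W p γ t → W * (1 + (3 + suc (suc t))) + p + 0 + γ ≡ p + γ + W * (6 + t)
      lhs = solve-∀
      rhs : ∀ W t → W * (1 + (3 + suc (suc t)) + 1) + 0 + 0 ≡ W + W * (6 + t) + 0
      rhs = solve-∀
  main : MainGapB 1 c 6666
  main = SqrtGap-by-bounds
    (√5-upper ∷ √13-upper ∷ tangent-upper 6 3334 X 2 tt 6≤X ≤-refl ∷ []) (√8-lower ∷ leading-lower (X + 1) 2 ∷ [])
    (linear 10000 22361 36056 3334 28284 6666 (evaluated tt))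
    where
    linear : ∀ W a b p q γ → a + b + p + 2 ≤ q + W + 5 * γ →
      sum (a ∷ b ∷ W * X + p ∷ []) + 2 ≤ sum (q ∷ W * (X + 1) ∷ []) + γ * c
    linear W a b p q γ = ≤-by-common-part (lhs W a b p t) (rhs W q γ t)
      where
      lhs : ∀ W a b p t → a + (b + (W * (1 + (3 + suc (suc t))) + p + 0)) + 2 ≡ a + b + p + 2 + W * (6 + t)
      lhs = solve-∀
      rhs : ∀ W q γ t → q + (W * (1 + (3 + suc (suc t)) + 1) + 0) + γ * (3 + suc (suc t))
                      ≡ q + W + 5 * γ + W * (6 + t) + γ * t
      rhs = solve-∀

gapB-m≥2 : ∀ z t → let m = suc (suc z) ; c = m + 2 + t ; γ = 10000 * z + 16000 in
           EdgeGapB m c γ × MainGapB m c γ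
gapB-m≥2 z t = edge , main
  where
  m = suc (suc z)
  c = m + 2 + t
  X = 1 + c
  5≤X : 5 ≤ X
  5≤X = s≤s (s≤s (s≤s (≤-trans (m≤n+m 2 z) (m≤m+n (z + 2) t))))
  edge : EdgeGapB m c (10000 * z + 16000)
  edge d _ d≤2 = SqrtGap-by-bounds (tangent-upper 5 4000 X d tt 5≤X d≤2 ∷ []) (leading-lower (X + m) d ∷ [])
    (linear 10000 4000 16000 (evaluated tt))
    where
    linear : ∀ W p g → p + g ≤ 2 * W → sum (W * X + p ∷ []) + (W * z + g) ≤ sum (W * (X + m) ∷ []) + 0
    linear W p g = ≤-by-common-part (lhs W p g z t) (rhs W z t)
      where
      lhs : ∀ W p g z t → W * (1 + (suc (suc z) + 2 + t)) + p + 0 + (W * z + g) ≡ p + g + W * (5 + 2 * z + t)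
      lhs = solve-∀
      rhs : ∀ W z t → W * (1 + (suc (suc z) + 2 + t) + suc (suc z)) + 0 + 0 ≡ 2 * W + W * (5 + 2 * z + t) + 0
      rhs = solve-∀
  main : MainGapB m c (10000 * z + 16000)
  main = SqrtGap-by-bounds
    (⌊√⌋-below-square 10000 (4 * m + m * m) (2 + m) (4m+m²<[2+m]² m) ∷
     tangent-upper 4 5000 (2 + m) 2 tt (m≤m+n 4 z) ≤-refl ∷ tangent-upper 5 4000 X 2 tt 5≤X ≤-refl ∷ [])
    (√8-lower ∷ leading-lower (X + m) 2 ∷ [])
    (linear 10000 5000 4000 28284 16000 (evaluated tt))
    where
    linear : ∀ W p₁ p₂ q g → p₁ + p₂ + 2 + 6 * W ≤ q + 4 * g →
      sum (W * (2 + m) ∷ W * (2 + m) + p₁ ∷ W * X + p₂ ∷ []) + 2 ≤ sum (q ∷ W * (X + m) ∷ []) + (W * z + g) * c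
    linear W p₁ p₂ q g = ≤-by-common-part (lhs W p₁ p₂ z t) (rhs W q g z t)
      where
      lhs : ∀ W p₁ p₂ z t →
        W * (2 + suc (suc z)) + (W * (2 + suc (suc z)) + p₁ + (W * (1 + (suc (suc z) + 2 + t)) + p₂ + 0)) + 2
          ≡ p₁ + p₂ + 2 + 6 * W + W * (7 + 3 * z + t)
      lhs = solve-∀
      rhs : ∀ W q g z t →
        q + (W * (1 + (suc (suc z) + 2 + t) + suc (suc z)) + 0) + (W * z + g) * (suc (suc z) + 2 + t)
          ≡ q + 4 * g + W * (7 + 3 * z + t) + (W * (3 * z + z * z + z * t) + g * z + g * t)
      rhs = solve-∀

opaque
  unfolding ⌊_√_⌋
  gapB-small : ∀ t → t < 2 → let c = 3 + t ; γ = ⌊ 10000 √ rad (2 + c) 2 ⌋ ∸ suc ⌊ 10000 √ rad (1 + c) 2 ⌋ in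
               EdgeGapB 1 c γ × MainGapB 1 c γ
  gapB-small 0 _ = one-or-two (SqrtGap-by-evaluation tt) (SqrtGap-by-evaluation tt) , SqrtGap-by-evaluation tt
  gapB-small 1 _ = one-or-two (SqrtGap-by-evaluation tt) (SqrtGap-by-evaluation tt) , SqrtGap-by-evaluation tt
  gapB-small (suc (suc _)) (s≤s (s≤s ()))

gapB : ∀ m c → 1 ≤ m → m + 2 ≤ c → ∃ λ γ → EdgeGapB m c γ × MainGapB m c γ
gapB 1 c _ m+2≤c with m≤n⇒∃[o]m+o≡n m+2≤c
... | 0           , refl = _ , gapB-small 0 (s≤s z≤n)
... | 1           , refl = _ , gapB-small 1 ≤-refl
... | suc (suc t) , refl = _ , gapB-m≡1 t
gapB (suc (suc z)) c _ m+2≤c with m≤n⇒∃[o]m+o≡n m+2≤c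
... | t , refl = _ , gapB-m≥2 z t

-- Sums over the vertex set

==-refl : (k : Fin n) → (k == k) ≡ true
==-refl k = trans (isYes≗does (k ≟ k)) (dec-true (k ≟ k) refl)

==-≢ : {j k : Fin n} → j ≢ k → (j == k) ≡ false
==-≢ {j = j} {k} j≢k = trans (isYes≗does (j ≟ k)) (dec-false (j ≟ k) j≢k)

∧-≡-true : ∀ {a b} → a ∧ b ≡ true → a ≡ true × b ≡ true
∧-≡-true {true} {true} _ = refl , refl

not-≡-true : ∀ {b} → not b ≡ true → b ≡ false
not-≡-true {false} _ = refl

==-false⇒≢ : {j k : Fin n} → (j == k) ≡ false → j ≢ k
==-false⇒≢ {k = k} jk refl = case (trans (sym jk) (==-refl k))
  where
  case : false ≡ true → ⊥
  case ()

∑-mono-≤ : {f g : Fin n → ℕ} → (∀ i → f i ≤ g i) → ∑ f ≤ ∑ g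
∑-mono-≤ {zero}  _     = z≤n
∑-mono-≤ {suc n} f≤g = +-mono-≤ (f≤g zero) (∑-mono-≤ (f≤g ∘ suc))

_without_ : (Fin n → ℕ) → Fin n → Fin n → ℕ
(f without k) j = if j == k then 0 else f j

without-≢ : ∀ (f : Fin n → ℕ) {j k} → j ≢ k → (f without k) j ≡ f j
without-≢ f j≢k rewrite ==-≢ j≢k = refl

∑-without : ∀ (f : Fin n → ℕ) k → ∑ f ≡ f k + ∑ (f without k)
∑-without {suc n} f k = begin
  ∑ f                                 ≡⟨ sum-remove {i = k} f ⟩
  f k + ∑ (f ∘ punchIn k)             ≡⟨ cong (f k +_) (sum-cong-≗ λ j → sym (without-≢ f (punchInᵢ≢i k j))) ⟩
  f k + ∑ ((f without k) ∘ punchIn k) ≡⟨ cong (f k +_) removed ⟨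
  f k + ∑ (f without k)               ∎
  where
  open ≡-Reasoning
  removed : ∑ (f without k) ≡ ∑ ((f without k) ∘ punchIn k)
  removed rewrite sum-remove {i = k} (f without k) | ==-refl k = refl

∑-≤-outside : ∀ {f g : Fin n → ℕ} {A B} ks → Unique ks → (∀ j → j ∉ ks → f j ≤ g j) →
              sum (map f ks) + A ≤ sum (map g ks) + B → ∑ f + A ≤ ∑ g + B
∑-≤-outside [] [] f≤g A≤B = +-mono-≤ (∑-mono-≤ λ j → f≤g j λ ()) A≤B
∑-≤-outside {f = f} {g} {A} {B} (k ∷ ks) (k≢ks ∷ unique) f≤g ≤at-ks = begin
  ∑ f + A                     ≡⟨ cong (_+ A) (∑-without f k) ⟩
  f k + ∑ (f without k) + A   ≡⟨ shuffle (f k) _ A ⟩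
  ∑ (f without k) + (A + f k) ≤⟨ ∑-≤-outside ks unique f≤g-without ≤at-ks′ ⟩
  ∑ (g without k) + (B + g k) ≡⟨ shuffle (g k) _ B ⟨
  g k + ∑ (g without k) + B   ≡⟨ cong (_+ B) (∑-without g k) ⟨
  ∑ g + B                     ∎
  where
  open ≤-Reasoning
  shuffle : ∀ a b c → a + b + c ≡ b + (c + a)
  shuffle = solve-∀
  f≤g-without : ∀ j → j ∉ ks → (f without k) j ≤ (g without k) j
  f≤g-without j j∉ks with j ≟ k
  ... | yes _   = ≤-refl
  ... | no  j≢k = f≤g j λ { (here j≡k) → j≢k j≡k ; (there j∈ks) → j∉ks j∈ks }
  sum-without : ∀ (h : Fin _ → ℕ) {ks} → All (k ≢_) ks → sum (map (h without k) ks) ≡ sum (map h ks)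
  sum-without h []             = refl
  sum-without h (k≢x ∷ k≢xs) = cong₂ _+_ (without-≢ h (k≢x ∘ sym)) (sum-without h k≢xs)
  ≤at-ks′ : sum (map (f without k) ks) + (A + f k) ≤ sum (map (g without k) ks) + (B + g k)
  ≤at-ks′ rewrite sum-without f k≢ks | sum-without g k≢ks =
    subst₂ _≤_ (shuffle′ (f k) _ A) (shuffle′ (g k) _ B) ≤at-ks
    where
    shuffle′ : ∀ a b c → a + b + c ≡ b + (c + a)
    shuffle′ = solve-∀

𝟙 : Bool → ℕ
𝟙 b = if b then 1 else 0

count-tabulate : ∀ {A : Set} (p : A → Bool) (f : Fin n → A) → count p (tabulate f) ≡ ∑ (𝟙 ∘ p ∘ f)
count-tabulate {zero}  p f = refl
count-tabulate {suc n} p f = cong (𝟙 (p (f zero)) +_) (count-tabulate p (f ∘ suc))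

deg-∑ : ∀ {N} (G : Adj N) a → deg G a ≡ ∑ (𝟙 ∘ G a)
deg-∑ G a = count-tabulate (G a) (λ j → j)

∑-𝟙-remove : ∀ (p : Fin n → Bool) {k} → p k ≡ true → ∑ (𝟙 ∘ p) ≡ suc (∑ λ j → 𝟙 (p j ∧ not (j == k)))
∑-𝟙-remove p {k} pk = trans (∑-without (𝟙 ∘ p) k) (cong₂ _+_ (cong 𝟙 pk) (sum-cong-≗ removed))
  where
  removed : ∀ j → ((𝟙 ∘ p) without k) j ≡ 𝟙 (p j ∧ not (j == k))
  removed j with j == k
  ... | true  rewrite ∧-zeroʳ (p j)     = refl
  ... | false rewrite ∧-identityʳ (p j) = refl

∑-𝟙-witness : ∀ (p : Fin n → Bool) → 0 < ∑ (𝟙 ∘ p) → ∃ λ j → p j ≡ true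
∑-𝟙-witness {suc n} p pos with p zero in p0
... | true  = zero , p0
... | false with ∑-𝟙-witness (p ∘ suc) pos
...   | j , pj = suc j , pj

∑-𝟙-≤ : ∀ (p : Fin n → Bool) → ∑ (𝟙 ∘ p) ≤ n
∑-𝟙-≤ {zero}  p = z≤n
∑-𝟙-≤ {suc n} p = +-mono-≤ (𝟙≤1 (p zero)) (∑-𝟙-≤ (p ∘ suc))
  where
  𝟙≤1 : ∀ b → 𝟙 b ≤ 1
  𝟙≤1 true  = ≤-refl
  𝟙≤1 false = z≤n

∑∑ : (Fin n → Fin n → ℕ) → ℕ
∑∑ f = ∑ λ i → ∑ (f i)

upper-triangle : (Fin n → Fin n → ℕ) → Fin n → Fin n → ℕ
upper-triangle f i j = if toℕ i <ᵇ toℕ j then f i j else 0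

∑∑-symmetric : ∀ (f : Fin n → Fin n → ℕ) → (∀ i j → f i j ≡ f j i) → (∀ i → f i i ≡ 0) →
               ∑∑ f ≡ ∑∑ (upper-triangle f) + ∑∑ (upper-triangle f)
∑∑-symmetric f f-sym f-diag = begin
  ∑∑ f                                                      ≡⟨ sum-cong-≗ (λ i → sum-cong-≗ (split i)) ⟩
  ∑ (λ i → ∑ λ j → F i j + F j i)                           ≡⟨ sum-cong-≗ (λ i → ∑-distrib-+ (F i) (λ j → F j i)) ⟩
  ∑ (λ i → ∑ (F i) + ∑ λ j → F j i)                         ≡⟨ ∑-distrib-+ (λ i → ∑ (F i)) (λ i → ∑ λ j → F j i) ⟩
  ∑∑ F + ∑ (λ i → ∑ λ j → F j i)                            ≡⟨ cong (∑∑ F +_) (∑-comm (λ i j → F j i)) ⟩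
  ∑∑ F + ∑∑ F                                               ∎
  where
  open ≡-Reasoning
  F = upper-triangle f
  split : ∀ i j → f i j ≡ upper-triangle f i j + upper-triangle f j i
  split i j with toℕ i <ᵇ toℕ j | <ᵇ-reflects-< (toℕ i) (toℕ j) | toℕ j <ᵇ toℕ i | <ᵇ-reflects-< (toℕ j) (toℕ i)
  ... | true  | ofʸ i<j | true  | ofʸ j<i = contradiction i<j (<-asym j<i)
  ... | true  | _       | false | _       = sym (+-identityʳ (f i j))
  ... | false | _       | true  | _       = f-sym i j
  ... | false | ofⁿ i≮j | false | ofⁿ j≮i rewrite toℕ-injective (≤-antisym (≮⇒≥ j≮i) (≮⇒≥ i≮j)) = f-diag j

module _ {s t : Fin n} (s≢t : s ≢ t) where

  off : (Fin n → ℕ) → Fin n → ℕ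
  off f = (f without s) without t

  ∑-off : ∀ (f : Fin n → ℕ) → ∑ f ≡ f s + f t + ∑ (off f)
  ∑-off f = begin
    ∑ f                                        ≡⟨ ∑-without f s ⟩
    f s + ∑ (f without s)                      ≡⟨ cong (f s +_) (∑-without (f without s) t) ⟩
    f s + ((f without s) t + ∑ (off f))        ≡⟨ cong (λ z → f s + (z + ∑ (off f))) (without-≢ f (s≢t ∘ sym)) ⟩
    f s + (f t + ∑ (off f))                    ≡⟨ +-assoc (f s) (f t) _ ⟨
    f s + f t + ∑ (off f)                      ∎
    where open ≡-Reasoning

  off-cong : ∀ {f g : Fin n → ℕ} → (∀ j → j ≢ s → j ≢ t → f j ≡ g j) → ∀ j → off f j ≡ off g j
  off-cong f≡g j with j ≟ t | j ≟ s
  ... | yes _   | _       = refl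
  ... | no  _   | yes _   = refl
  ... | no  j≢t | no  j≢s = f≡g j j≢s j≢t

  ∑-cong-off : ∀ {f g : Fin n → ℕ} → (∀ j → j ≢ s → j ≢ t → f j ≡ g j) → f s + f t ≡ g s + g t → ∑ f ≡ ∑ g
  ∑-cong-off {f} {g} f≡g ends = begin
    ∑ f                   ≡⟨ ∑-off f ⟩
    f s + f t + ∑ (off f) ≡⟨ cong₂ _+_ ends (sum-cong-≗ (off-cong f≡g)) ⟩
    g s + g t + ∑ (off g) ≡⟨ ∑-off g ⟨
    ∑ g                   ∎
    where open ≡-Reasoning

  core : (Fin n → Fin n → ℕ) → ℕ
  core f = ∑ (off λ i → ∑ (off (f i)))

  ∑∑-split : ∀ (f : Fin n → Fin n → ℕ) → (∀ i j → f i j ≡ f j i) → f s s ≡ 0 → f t t ≡ 0 → f s t ≡ 0 →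
             ∑∑ f ≡ ∑ (f s) + ∑ (f t) + (∑ (f s) + ∑ (f t) + core f)
  ∑∑-split f f-sym fss ftt fst = begin
    ∑∑ f                                              ≡⟨ sum-cong-≗ (λ i → ∑-off (f i)) ⟩
    ∑ (λ i → f i s + f i t + R i)                     ≡⟨ ∑-distrib-+ (λ i → f i s + f i t) R ⟩
    ∑ (λ i → f i s + f i t) + ∑ R                     ≡⟨ cong (_+ ∑ R) (∑-distrib-+ (λ i → f i s) (λ i → f i t)) ⟩
    ∑ (λ i → f i s) + ∑ (λ i → f i t) + ∑ R           ≡⟨ cong₂ (λ a b → a + b + ∑ R)
                                                           (sum-cong-≗ (λ i → f-sym i s)) (sum-cong-≗ (λ i → f-sym i t)) ⟩
    ∑ (f s) + ∑ (f t) + ∑ R                           ≡⟨ cong (∑ (f s) + ∑ (f t) +_) (∑-off R) ⟩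
    ∑ (f s) + ∑ (f t) + (R s + R t + core f)          ≡⟨ cong (λ z → ∑ (f s) + ∑ (f t) + (z + core f))
                                                           (cong₂ _+_ (sym R-s) (sym R-t)) ⟩
    ∑ (f s) + ∑ (f t) + (∑ (f s) + ∑ (f t) + core f)  ∎
    where
    open ≡-Reasoning
    R : Fin n → ℕ
    R i = ∑ (off (f i))
    R-s : ∑ (f s) ≡ R s
    R-s rewrite ∑-off (f s) | fss | fst = refl
    R-t : ∑ (f t) ≡ R t
    R-t rewrite ∑-off (f t) | f-sym t s | fst | ftt = refl

  ∑∑-local-change : ∀ (f g : Fin n → Fin n → ℕ) {e} →
    (∀ i j → f i j ≡ f j i) → f s s ≡ 0 → f t t ≡ 0 → f s t ≡ 0 →
    (∀ i j → g i j ≡ g j i) → g s s ≡ 0 → g t t ≡ 0 → g s t ≡ 0 →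
    (∀ i j → i ≢ s → i ≢ t → j ≢ s → j ≢ t → f i j ≡ g i j) →
    ∑ (f s) + ∑ (f t) + e ≤ ∑ (g s) + ∑ (g t) → ∑∑ f + (e + e) ≤ ∑∑ g
  ∑∑-local-change f g {e} f-sym fss ftt fst g-sym gss gtt gst f≡g rows = begin
    ∑∑ f + (e + e)                      ≡⟨ cong (_+ (e + e)) (∑∑-split f f-sym fss ftt fst) ⟩
    Rf + (Rf + core f) + (e + e)        ≡⟨ shuffle Rf (core f) e ⟩
    Rf + e + (Rf + e + core f)          ≤⟨ +-mono-≤ rows (+-mono-≤ rows (≤-reflexive core-f≡g)) ⟩
    Rg + (Rg + core g)                  ≡⟨ ∑∑-split g g-sym gss gtt gst ⟨
    ∑∑ g                                ∎
    where
    open ≤-Reasoning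
    Rf = ∑ (f s) + ∑ (f t)
    Rg = ∑ (g s) + ∑ (g t)
    shuffle : ∀ r c e → r + (r + c) + (e + e) ≡ r + e + (r + e + c)
    shuffle = solve-∀
    core-f≡g : core f ≡ core g
    core-f≡g = sum-cong-≗ (off-cong λ i i≢s i≢t → sum-cong-≗ (off-cong λ j j≢s j≢t → f≡g i j i≢s i≢t j≢s j≢t))

-- Sombor sums

φ : ∀ {N} → (ℕ → ℕ) → Adj N → Fin N → Fin N → ℕ
φ c G i j = if G i j then c (rad (deg G i) (deg G j)) else 0

φ-edge : ∀ {N} c (G : Adj N) i j → G i j ≡ true → φ c G i j ≡ c (rad (deg G i) (deg G j))
φ-edge c G i j ij rewrite ij = refl

φ-non-edge : ∀ {N} c (G : Adj N) i j → G i j ≡ false → φ c G i j ≡ 0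
φ-non-edge c G i j ij rewrite ij = refl

φ-symmetric : ∀ {N} c (G : Adj N) → Simple G → ∀ i j → φ c G i j ≡ φ c G j i
φ-symmetric c G (G-sym , _) i j rewrite G-sym i j | +-comm (deg G i * deg G i) (deg G j * deg G j) = refl

sum-concatMap-tabulate : ∀ {A B : Set} (c : A → ℕ) (F : B → List A) (g : Fin n → B) →
                         sum (map c (concatMap F (tabulate g))) ≡ ∑ (λ i → sum (map c (F (g i))))
sum-concatMap-tabulate {zero}  c F g = refl
sum-concatMap-tabulate {suc n} c F g = begin
  sum (map c (F (g zero) ++ concatMap F (tabulate (g ∘ suc))))             ≡⟨ cong sum (map-++ c (F (g zero)) _) ⟩
  sum (map c (F (g zero)) ++ map c (concatMap F (tabulate (g ∘ suc))))     ≡⟨ sum-++ (map c (F (g zero))) _ ⟩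
  sum (map c (F (g zero))) + sum (map c (concatMap F (tabulate (g ∘ suc)))) ≡⟨ cong (sum (map c (F (g zero))) +_)
                                                                               (sum-concatMap-tabulate c F (g ∘ suc)) ⟩
  sum (map c (F (g zero))) + ∑ (λ i → sum (map c (F (g (suc i)))))         ∎
  where open ≡-Reasoning

sum-soRadicands : ∀ {N} (c : ℕ → ℕ) (G : Adj N) → sum (map c (soRadicands G)) ≡ ∑∑ (upper-triangle (φ c G))
sum-soRadicands {N} c G = begin
  sum (map c (soRadicands G))   ≡⟨ cong sum (map-∘ (edges G)) ⟨
  sum (map (c ∘ radicand) (edges G)) ≡⟨ sum-concatMap-tabulate (c ∘ radicand) (λ i → concatMap (edge-at i) (allFin N)) id ⟩
  ∑ (λ i → sum (map (c ∘ radicand) (concatMap (edge-at i) (allFin N)))) ≡⟨ sum-cong-≗ (λ i →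
                                                                          sum-concatMap-tabulate (c ∘ radicand) (edge-at i) id) ⟩
  ∑ (λ i → ∑ λ j → sum (map (c ∘ radicand) (edge-at i j))) ≡⟨ sum-cong-≗ (λ i → sum-cong-≗ (weight i)) ⟩
  ∑∑ (upper-triangle (φ c G))   ∎
  where
  open ≡-Reasoning
  radicand : Fin N × Fin N → ℕ
  radicand (i , j) = deg G i ^ 2 + deg G j ^ 2
  edge-at : Fin N → Fin N → List (Fin N × Fin N)
  edge-at i j = if G i j ∧ (toℕ i <ᵇ toℕ j) then [ (i , j) ] else []
  square : ∀ x → x ^ 2 ≡ x * x
  square x = cong (x *_) (*-identityʳ x)
  weight : ∀ i j → sum (map (c ∘ radicand) (edge-at i j)) ≡ upper-triangle (φ c G) i j
  weight i j with G i j | toℕ i <ᵇ toℕ j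
  ... | true  | true  = trans (+-identityʳ _) (cong c (cong₂ _+_ (square (deg G i)) (square (deg G j))))
  ... | true  | false = refl
  ... | false | true  = refl
  ... | false | false = refl

record LocalChange {N} (G H : Adj N) (s t : Fin N) : Set where
  field
    G-simple : Simple G
    H-simple : Simple H
    s≢t      : s ≢ t
    G-st     : G s t ≡ false
    H-st     : H s t ≡ false
    deg-off  : ∀ z → z ≢ s → z ≢ t → deg H z ≡ deg G z
    adj-off  : ∀ i j → i ≢ s → i ≢ t → j ≢ s → j ≢ t → H i j ≡ G i j

-- Twice a Sombor sum is the sum of φ over ordered pairs.  There, rounding all terms of G up adds
-- at most N² < e, while the rows at s and t, counted twice, gain 2e.
SOlt-by-rows : ∀ {N} K .{{_ : NonZero K}} e {G H : Adj N} {s t} → LocalChange G H s t → N * N < e →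
  ∑ (φ ⌊ K √_⌋ G s) + ∑ (φ ⌊ K √_⌋ G t) + e ≤ ∑ (φ ⌊ K √_⌋ H s) + ∑ (φ ⌊ K √_⌋ H t) → SOlt G H
SOlt-by-rows {N} K e {G} {H} {s} {t} change N²<e rows =
  SqrtSumLt-by-floors K (soRadicands G) (soRadicands H) $
    subst₂ _<_ (sym (sum-soRadicands (suc ∘ fK) G)) (sym (sum-soRadicands fK H)) (half-< (begin-strict
      U₁ + U₁                          ≡⟨ ∑∑-symmetric φG⁺ (φ-symmetric (suc ∘ fK) G G-simple) (diagonal (suc ∘ fK) G-simple) ⟨
      ∑∑ φG⁺                           ≡⟨ sum-cong-≗ (λ i → trans (sum-cong-≗ (φ-suc i)) (∑-distrib-+ (φG i) (𝟙 ∘ G i))) ⟩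
      ∑ (λ i → ∑ (φG i) + ∑ (𝟙 ∘ G i)) ≡⟨ ∑-distrib-+ (λ i → ∑ (φG i)) (λ i → ∑ (𝟙 ∘ G i)) ⟩
      ∑∑ φG + ∑ (λ i → ∑ (𝟙 ∘ G i))    ≤⟨ +-monoʳ-≤ (∑∑ φG) degree-sum ⟩
      ∑∑ φG + N * N                    <⟨ +-monoʳ-< (∑∑ φG) N²<e ⟩
      ∑∑ φG + e                        ≤⟨ +-monoʳ-≤ (∑∑ φG) (m≤m+n e e) ⟩
      ∑∑ φG + (e + e)                  ≤⟨ ∑∑-local-change s≢t φG φH
                                            (φ-symmetric fK G G-simple) (diagonal fK G-simple s) (diagonal fK G-simple t)
                                            (φ-non-edge fK G s t G-st)
                                            (φ-symmetric fK H H-simple) (diagonal fK H-simple s) (diagonal fK H-simple t)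
                                            (φ-non-edge fK H s t H-st)
                                            off-equal rows ⟩
      ∑∑ φH                            ≡⟨ ∑∑-symmetric φH (φ-symmetric fK H H-simple) (diagonal fK H-simple) ⟩
      U₂ + U₂                          ∎))
  where
  open LocalChange change
  open ≤-Reasoning
  fK = ⌊ K √_⌋
  φG = φ fK G
  φG⁺ = φ (suc ∘ fK) G
  φH = φ fK H
  U₁ = ∑∑ (upper-triangle φG⁺)
  U₂ = ∑∑ (upper-triangle φH)
  half-< : ∀ {m n} → m + m < n + n → m < n
  half-< m+m<n+n = ≰⇒> λ n≤m → <⇒≱ m+m<n+n (+-mono-≤ n≤m n≤m)
  diagonal : ∀ c {J : Adj N} → Simple J → ∀ i → φ c J i i ≡ 0
  diagonal c {J} (_ , J-loop) i = φ-non-edge c J i i (J-loop i)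
  φ-suc : ∀ i j → φG⁺ i j ≡ φG i j + 𝟙 (G i j)
  φ-suc i j with G i j
  ... | true  = sym (+-comm _ 1)
  ... | false = refl
  ∑-const : ∀ {m} c → ∑ {m} (λ _ → c) ≡ m * c
  ∑-const {zero}  c = refl
  ∑-const {suc m} c = cong (c +_) (∑-const {m} c)
  degree-sum : ∑ (λ i → ∑ (𝟙 ∘ G i)) ≤ N * N
  degree-sum = ≤-trans (∑-mono-≤ (λ i → ∑-𝟙-≤ (G i))) (≤-reflexive (∑-const {N} N))
  off-equal : ∀ i j → i ≢ s → i ≢ t → j ≢ s → j ≢ t → φG i j ≡ φH i j
  off-equal i j i≢s i≢t j≢s j≢t
    rewrite adj-off i j i≢s i≢t j≢s j≢t | deg-off i i≢s i≢t | deg-off j j≢s j≢t = refl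

-- Moving edges between two vertices

module OtherNeighbours {N} (G : Adj N) (a p q : Fin N) where

  other : Fin N → Bool
  other z = G a z ∧ not (z == p) ∧ not (z == q)

  other-sound : ∀ {z} → other z ≡ true → G a z ≡ true × z ≢ p × z ≢ q
  other-sound {z} oz with ∧-≡-true {G a z} oz
  ... | az , rest with ∧-≡-true {not (z == p)} rest
  ...   | z≠p , z≠q = az , ==-false⇒≢ (not-≡-true z≠p) , ==-false⇒≢ (not-≡-true z≠q)

  other-complete : ∀ {z} → G a z ≡ true → z ≢ p → z ≢ q → other z ≡ true
  other-complete az z≢p z≢q rewrite az | ==-≢ z≢p | ==-≢ z≢q = refl

  other-p : other p ≡ false
  other-p rewrite ==-refl p | ∧-zeroʳ (G a p) = refl

  other-q : other q ≡ false
  other-q rewrite ==-refl q | ∧-zeroʳ (not (q == p)) | ∧-zeroʳ (G a q) = refl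

  deg-other : G a p ≡ true → G a q ≡ true → q ≢ p → deg G a ≡ 2 + ∑ (𝟙 ∘ other)
  deg-other ap aq q≢p = begin
    deg G a                                                ≡⟨ deg-∑ G a ⟩
    ∑ (𝟙 ∘ G a)                                            ≡⟨ ∑-𝟙-remove (G a) ap ⟩
    suc (∑ λ j → 𝟙 (G a j ∧ not (j == p)))                ≡⟨ cong suc (∑-𝟙-remove (λ j → G a j ∧ not (j == p)) aq′) ⟩
    2 + ∑ (λ j → 𝟙 ((G a j ∧ not (j == p)) ∧ not (j == q))) ≡⟨ cong (2 +_) (sum-cong-≗ λ j → cong 𝟙 (∧-assoc (G a j) _ _)) ⟩
    2 + ∑ (𝟙 ∘ other)                                      ∎
    where
    open ≡-Reasoning
    aq′ : (G a q ∧ not (q == p)) ≡ true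
    aq′ rewrite aq | ==-≢ q≢p = refl

module Transfer {N} (G : Adj N) (G-simple : Simple G) (M : Fin N → Bool) {s t : Fin N} (s≢t : s ≢ t)
  (G-st : G s t ≡ false) (M⊆N[s]∖N[t] : ∀ z → M z ≡ true → G s z ≡ true × G t z ≡ false) where

  H : Adj N
  H = transfer G M s t

  private
    G-sym = proj₁ G-simple
    G-loop = proj₂ G-simple


  M-s : M s ≡ false
  M-s with M s in Ms
  ... | true  = contradiction (trans (sym (proj₁ (M⊆N[s]∖N[t] s Ms))) (G-loop s)) true≢false
  ... | false = refl

  M-t : M t ≡ false
  M-t with M t in Mt
  ... | true  = contradiction (trans (sym (proj₁ (M⊆N[s]∖N[t] t Mt))) G-st) true≢false
  ... | false = refl

  row-s : ∀ j → H s j ≡ (if M j then false else G s j)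
  row-s j rewrite ==-refl s | ==-≢ s≢t | M-s | ∧-zeroʳ (j == s) | ∧-zeroʳ (j == t) | ∨-identityʳ (M j) = refl

  row-t : ∀ j → H t j ≡ (if M j then true else G t j)
  row-t j rewrite ==-refl t | ==-≢ (s≢t ∘ sym) | M-t | ∧-zeroʳ (j == s) | ∧-zeroʳ (j == t) | ∨-identityʳ (M j) = refl

  row-other : ∀ {z} j → z ≢ s → z ≢ t →
              H z j ≡ (if (j == s) ∧ M z then false else if (j == t) ∧ M z then true else G z j)
  row-other j z≢s z≢t rewrite ==-≢ z≢s | ==-≢ z≢t = refl

  adj-off : ∀ i j → i ≢ s → i ≢ t → j ≢ s → j ≢ t → H i j ≡ G i j
  adj-off i j i≢s i≢t j≢s j≢t rewrite row-other j i≢s i≢t | ==-≢ j≢s | ==-≢ j≢t = refl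

  H-simple : Simple H
  H-simple = H-sym , H-loop
    where
    H-sym : ∀ a b → H a b ≡ H b a
    H-sym a b rewrite ∨-comm ((a == s) ∧ M b) ((b == s) ∧ M a) | ∨-comm ((a == t) ∧ M b) ((b == t) ∧ M a)
                    | G-sym a b = refl
    H-loop : ∀ a → H a a ≡ false
    H-loop a = loop (a ≟ s) (a ≟ t)
      where
      loop : Dec (a ≡ s) → Dec (a ≡ t) → H a a ≡ false
      loop (yes refl) _          rewrite row-s s | M-s = G-loop s
      loop (no _)     (yes refl) rewrite row-t t | M-t = G-loop t
      loop (no a≢s)   (no a≢t)   = trans (adj-off a a a≢s a≢t a≢s a≢t) (G-loop a)

  H-st : H s t ≡ false
  H-st rewrite row-s t | M-t = G-st

  ∣M∣ : ℕ
  ∣M∣ = ∑ (𝟙 ∘ M)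

  deg-s : deg H s + ∣M∣ ≡ deg G s
  deg-s rewrite deg-∑ H s | deg-∑ G s = trans (sym (∑-distrib-+ (𝟙 ∘ H s) (𝟙 ∘ M))) (sum-cong-≗ moved)
    where
    moved : ∀ j → 𝟙 (H s j) + 𝟙 (M j) ≡ 𝟙 (G s j)
    moved j rewrite row-s j with M j in Mj
    ... | true  rewrite proj₁ (M⊆N[s]∖N[t] j Mj) = refl
    ... | false = +-identityʳ _

  deg-t : deg H t ≡ deg G t + ∣M∣
  deg-t rewrite deg-∑ H t | deg-∑ G t = trans (sum-cong-≗ moved) (∑-distrib-+ (𝟙 ∘ G t) (𝟙 ∘ M))
    where
    moved : ∀ j → 𝟙 (H t j) ≡ 𝟙 (G t j) + 𝟙 (M j)
    moved j rewrite row-t j with M j in Mj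
    ... | true  rewrite proj₂ (M⊆N[s]∖N[t] j Mj) = refl
    ... | false = sym (+-identityʳ _)

  deg-off : ∀ z → z ≢ s → z ≢ t → deg H z ≡ deg G z
  deg-off z z≢s z≢t rewrite deg-∑ H z | deg-∑ G z =
    ∑-cong-off s≢t (λ j j≢s j≢t → cong 𝟙 (adj-off z j z≢s z≢t j≢s j≢t)) ends
    where
    ends : 𝟙 (H z s) + 𝟙 (H z t) ≡ 𝟙 (G z s) + 𝟙 (G z t)
    ends rewrite row-other s z≢s z≢t | row-other t z≢s z≢t | ==-refl s | ==-refl t | ==-≢ s≢t | ==-≢ (s≢t ∘ sym)
      with M z in Mz
    ... | true  rewrite G-sym z s | G-sym z t | proj₁ (M⊆N[s]∖N[t] z Mz) | proj₂ (M⊆N[s]∖N[t] z Mz) = refl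
    ... | false = refl

  local-change : LocalChange G H s t
  local-change = record
    { G-simple = G-simple ; H-simple = H-simple ; s≢t = s≢t ; G-st = G-st ; H-st = H-st
    ; deg-off = deg-off ; adj-off = adj-off }

  ψ : (ℕ → ℕ) → Adj N → Fin N → ℕ
  ψ c J j = φ c J s j + φ c J t j

  module _ (c : ℕ → ℕ) (c-mono : ∀ {a b} → a ≤ b → c a ≤ c b) where

    private
      c-rad-mono : ∀ d {a b} → a ≤ b → c (rad a d) ≤ c (rad b d)
      c-rad-mono d a≤b = c-mono (+-monoˡ-≤ _ (*-mono-≤ a≤b a≤b))

    ψ-moved : deg G s ≤ deg H t → ∀ {j} → M j ≡ true → ψ c G j ≤ ψ c H j
    ψ-moved dGs≤dHt {j} Mj = begin
      φ c G s j + φ c G t j           ≡⟨ cong₂ _+_ (φ-edge c G s j Gsj) (φ-non-edge c G t j Gtj) ⟩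
      c (rad (deg G s) (deg G j)) + 0 ≤⟨ +-monoˡ-≤ 0 (c-rad-mono (deg G j) dGs≤dHt) ⟩
      c (rad (deg H t) (deg G j)) + 0 ≡⟨ +-comm _ 0 ⟩
      0 + c (rad (deg H t) (deg G j)) ≡⟨ cong₂ _+_ (φ-non-edge c H s j Hsj)
                                                   (trans (φ-edge c H t j Htj) (cong (λ d → c (rad (deg H t) d)) dHj)) ⟨
      φ c H s j + φ c H t j           ∎
      where
      open ≤-Reasoning
      Gsj = proj₁ (M⊆N[s]∖N[t] j Mj)
      Gtj = proj₂ (M⊆N[s]∖N[t] j Mj)
      Hsj : H s j ≡ false
      Hsj rewrite row-s j | Mj = refl
      Htj : H t j ≡ true
      Htj rewrite row-t j | Mj = refl
      dHj : deg H j ≡ deg G j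
      dHj = deg-off j (λ { refl → contradiction (trans (sym Gsj) (G-loop s)) true≢false })
                      (λ { refl → contradiction (trans (sym Gsj) G-st) true≢false })

    ψ-kept : ∀ {j} → M j ≡ false → G s j ≡ false → ψ c G j ≤ ψ c H j
    ψ-kept {j} Mj Gsj = +-mono-≤ (≤-reflexive (trans (φ-non-edge c G s j Gsj) (sym (φ-non-edge c H s j Hsj))))
                                 (t-part (G t j) refl)
      where
      Hsj : H s j ≡ false
      Hsj rewrite row-s j | Mj = Gsj
      t-part : ∀ b → G t j ≡ b → φ c G t j ≤ φ c H t j
      t-part false Gtj = ≤-trans (≤-reflexive (φ-non-edge c G t j Gtj)) z≤n
      t-part true  Gtj = begin
        φ c G t j                   ≡⟨ φ-edge c G t j Gtj ⟩
        c (rad (deg G t) (deg G j)) ≤⟨ c-rad-mono (deg G j) (≤-trans (m≤m+n (deg G t) ∣M∣) (≤-reflexive (sym deg-t))) ⟩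
        c (rad (deg H t) (deg G j)) ≡⟨ cong (λ d → c (rad (deg H t) d)) dHj ⟨
        c (rad (deg H t) (deg H j)) ≡⟨ φ-edge c H t j Htj ⟨
        φ c H t j                   ∎
        where
        open ≤-Reasoning
        Htj : H t j ≡ true
        Htj rewrite row-t j | Mj = Gtj
        dHj : deg H j ≡ deg G j
        dHj = deg-off j (λ { refl → contradiction (trans (sym Gtj) (trans (G-sym t s) G-st)) true≢false })
                        (λ { refl → contradiction (trans (sym Gtj) (G-loop t)) true≢false })

    ψ-mono : deg G s ≤ deg H t → ∀ j → (G s j ≡ true → M j ≡ true) → ψ c G j ≤ ψ c H j
    ψ-mono dGs≤dHt j Gsj⇒Mj = by-cases (M j) (G s j) refl refl
      where
      by-cases : ∀ m g → M j ≡ m → G s j ≡ g → ψ c G j ≤ ψ c H j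
      by-cases true  _     Mj _   = ψ-moved dGs≤dHt Mj
      by-cases false false Mj Gsj = ψ-kept Mj Gsj
      by-cases false true  Mj Gsj = contradiction (trans (sym (Gsj⇒Mj Gsj)) Mj) true≢false

  ∑-ψ : ∀ c J → ∑ (ψ c J) ≡ ∑ (φ c J s) + ∑ (φ c J t)
  ∑-ψ c J = ∑-distrib-+ (φ c J s) (φ c J t)

private
  ∈-zip : ∀ {A B : Set} {a : A} {b : B} xs ys → (a , b) ∈ zip xs ys → a ∈ xs × b ∈ ys
  ∈-zip (x ∷ xs) (y ∷ ys) (here refl) = here refl , here refl
  ∈-zip (x ∷ xs) (y ∷ ys) (there ab∈) = there (proj₁ (∈-zip xs ys ab∈)) , there (proj₂ (∈-zip xs ys ab∈))

  ∈-snoc : ∀ {A : Set} {a c : A} cs → a ∈ cs ++ [ c ] → a ∈ c ∷ cs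
  ∈-snoc cs a∈ with ∈-++⁻ cs a∈
  ... | inj₁ a∈cs        = there a∈cs
  ... | inj₂ (here refl) = here refl

∈-cycPairs : ∀ {N} {a b : Fin N} C → (a , b) ∈ cycPairs C → a ∈ C × b ∈ C
∈-cycPairs (c ∷ cs) ab∈ = proj₁ (∈-zip (c ∷ cs) _ ab∈) , ∈-snoc cs (proj₂ (∈-zip (c ∷ cs) _ ab∈))

CycEdge-∈ : ∀ {N} {a b : Fin N} C → CycEdge C a b → a ∈ C × b ∈ C
CycEdge-∈ C (inj₁ ab∈) = ∈-cycPairs C ab∈
CycEdge-∈ C (inj₂ ba∈) = proj₂ (∈-cycPairs C ba∈) , proj₁ (∈-cycPairs C ba∈)

module Configuration {N k} (G : Adj N) (C : List (Fin N)) (x u y w v : Fin N)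
  (G∈U : InU k G C) (x≢y : x ≢ y) (xu : CycEdge C x u) (uy : CycEdge C u y)
  (w∉C : w ∉ C) (v∉C : v ∉ C) (uw : G u w ≡ true) (wv : G w v ≡ true)
  (deg-w : deg G w ≡ 2) (deg-v : 3 ≤ deg G v)
  (T*-branching : ∀ z → Reach (deleteEdge G u w) w z → 3 ≤ deg G z → z ≡ v) where

  G-simple : Simple G
  G-simple = proj₁ (proj₁ G∈U)

  private
    G-sym = proj₁ G-simple
    G-loop = proj₂ G-simple

    adjacent-≢ : ∀ {a b} → G a b ≡ true → a ≢ b
    adjacent-≢ {a} ab refl = contradiction (trans (sym ab) (G-loop a)) true≢false

    C-cycle : IsCycle G C
    C-cycle = proj₁ (proj₂ (proj₂ (proj₁ G∈U)))

    only-cycle : ∀ D → IsCycle G D → ∀ a b → CycEdge D a b → CycEdge C a b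
    only-cycle D D-cycle a b = Equivalence.to (proj₂ (proj₂ (proj₂ (proj₁ G∈U))) D D-cycle a b)

    C-edge : ∀ {a b} → CycEdge C a b → G a b ≡ true
    C-edge (inj₁ ab∈) = lookup (proj₂ (proj₂ C-cycle)) ab∈
    C-edge {a} {b} (inj₂ ba∈) = trans (G-sym a b) (lookup (proj₂ (proj₂ C-cycle)) ba∈)

  u∈C : u ∈ C
  u∈C = proj₂ (CycEdge-∈ C xu)

  ∉C-≢ : ∀ {a b} → a ∈ C → b ∉ C → a ≢ b
  ∉C-≢ a∈C b∉C refl = b∉C a∈C

  u≢v : u ≢ v
  u≢v = ∉C-≢ u∈C v∉C

  uw-on-no-cycle : ∀ D → IsCycle G D → (u , w) ∈ cycPairs D → ⊥
  uw-on-no-cycle D D-cycle uw∈D = w∉C (proj₂ (CycEdge-∈ C (only-cycle D D-cycle u w (inj₁ uw∈D))))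

  uv : G u v ≡ false
  uv with G u v in uv′
  ... | false = refl
  ... | true  = ⊥-elim (uw-on-no-cycle (u ∷ w ∷ v ∷ []) triangle (here refl))
    where
    triangle : IsCycle G (u ∷ w ∷ v ∷ [])
    triangle = s≤s (s≤s (s≤s z≤n)) ,
      ((adjacent-≢ uw ∷ u≢v ∷ []) ∷ (adjacent-≢ wv ∷ []) ∷ [] ∷ []) ,
      (uw ∷ wv ∷ trans (G-sym v u) uv′ ∷ [])

  no-common-neighbour : ∀ {j} → j ≢ w → G u j ≡ true → G v j ≡ true → ⊥
  no-common-neighbour {j} j≢w uj vj = uw-on-no-cycle (u ∷ w ∷ v ∷ j ∷ []) square (here refl)
    where
    square : IsCycle G (u ∷ w ∷ v ∷ j ∷ [])
    square = s≤s (s≤s (s≤s z≤n)) ,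
      ((adjacent-≢ uw ∷ u≢v ∷ adjacent-≢ uj ∷ []) ∷ (adjacent-≢ wv ∷ (j≢w ∘ sym) ∷ []) ∷
       (adjacent-≢ vj ∷ []) ∷ [] ∷ []) ,
      (uw ∷ wv ∷ vj ∷ trans (G-sym j u) uj ∷ [])

  ¬u-neighbour : ∀ {j} → j ≢ w → G v j ≡ true → G u j ≡ false
  ¬u-neighbour {j} j≢w vj with G u j in uj
  ... | false = refl
  ... | true  = ⊥-elim (no-common-neighbour j≢w uj vj)

  ¬v-neighbour : ∀ {j} → j ≢ w → G u j ≡ true → G v j ≡ false
  ¬v-neighbour {j} j≢w uj with G v j in vj
  ... | false = refl
  ... | true  = ⊥-elim (no-common-neighbour j≢w uj vj)

  v-neighbour-≢ : ∀ {j} → G v j ≡ true → j ≢ v × j ≢ u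
  v-neighbour-≢ vj =
    adjacent-≢ vj ∘ sym , λ { refl → contradiction (trans (sym vj) (trans (G-sym v u) uv)) true≢false }

  v-neighbour-deg≤2 : ∀ {j} → G v j ≡ true → j ≢ w → deg G j ≤ 2
  v-neighbour-deg≤2 {j} vj j≢w with 3 ≤? deg G j
  ... | no  3≰dj = ≤-pred (≰⇒> 3≰dj)
  ... | yes 3≤dj = contradiction (T*-branching j (step w→v (step v→j here)) 3≤dj) (adjacent-≢ vj ∘ sym)
    where
    w→v : deleteEdge G u w w v ≡ true
    w→v rewrite wv | ==-≢ (adjacent-≢ uw ∘ sym) | ==-refl w | ==-≢ (u≢v ∘ sym) = refl
    v→j : deleteEdge G u w v j ≡ true
    v→j rewrite vj | ==-≢ (u≢v ∘ sym) | ==-≢ (adjacent-≢ wv ∘ sym) = refl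

  neighbour-deg-pos : ∀ {a j} → G a j ≡ true → 1 ≤ deg G j
  neighbour-deg-pos {a} {j} aj rewrite deg-∑ G j | ∑-𝟙-remove (G j) (trans (G-sym j a) aj) = s≤s z≤n

  slack : ℕ
  slack = suc (N * N)

  ω : ℕ → ℕ
  ω = ⌊ slack * 10000 √_⌋

  ω-mono : ∀ {R R′} → R ≤ R′ → ω R ≤ ω R′
  ω-mono = ⌊√⌋-mono-≤ (slack * 10000)

  φ-at : ∀ (J : Adj N) i j {a b} → J i j ≡ true → deg J i ≡ a → deg J j ≡ b → φ ω J i j ≡ ω (rad a b)
  φ-at J i j ij refl refl = φ-edge ω J i j ij

  module PartA (dv≤du : deg G v ≤ deg G u) (v₁ : Fin N) (vv₁ : G v v₁ ≡ true) (v₁≢w : v₁ ≢ w) where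

    open OtherNeighbours G v w v₁ renaming (other to Ma)

    Ma⊆N[v]∖N[u] : ∀ z → Ma z ≡ true → G v z ≡ true × G u z ≡ false
    Ma⊆N[v]∖N[u] z Mz with other-sound Mz
    ... | vz , z≢w , _ = vz , ¬u-neighbour z≢w vz

    open Transfer G G-simple Ma (u≢v ∘ sym) (trans (G-sym v u) uv) Ma⊆N[v]∖N[u]

    m : ℕ
    m = ∣M∣

    deg-v≡ : deg G v ≡ 2 + m
    deg-v≡ = deg-other (trans (G-sym v w) wv) vv₁ v₁≢w

    1≤m : 1 ≤ m
    1≤m = ≤-pred (≤-pred (subst (3 ≤_) deg-v≡ deg-v))

    v₂ : Fin N
    v₂ = proj₁ (∑-𝟙-witness Ma 1≤m)

    Mv₂ : Ma v₂ ≡ true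
    Mv₂ = proj₂ (∑-𝟙-witness Ma 1≤m)

    deg-Hv : deg H v ≡ 2
    deg-Hv = +-cancelʳ-≡ m (deg H v) 2 (trans deg-s deg-v≡)

    private
      v₂-facts = other-sound Mv₂
      vv₂ = proj₁ v₂-facts
      d₁ = deg G v₁
      d₂ = deg G v₂
      a = deg G u

    ψG-w : ψ ω G w ≡ ω (rad (2 + m) 2) + ω (rad a 2)
    ψG-w = cong₂ _+_ (φ-at G v w (trans (G-sym v w) wv) deg-v≡ deg-w) (φ-at G u w uw refl deg-w)

    ψH-w : ψ ω H w ≡ ω (rad 2 2) + ω (rad (a + m) 2)
    ψH-w = cong₂ _+_ (φ-at H v w Hvw deg-Hv deg-Hw) (φ-at H u w Huw deg-t deg-Hw)
      where
      deg-Hw : deg H w ≡ 2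
      deg-Hw = trans (deg-off w (adjacent-≢ wv) (adjacent-≢ uw ∘ sym)) deg-w
      Hvw : H v w ≡ true
      Hvw rewrite row-s w | other-p = trans (G-sym v w) wv
      Huw : H u w ≡ true
      Huw rewrite row-t w | other-p = uw

    ψG-v₁ : ψ ω G v₁ ≡ ω (rad (2 + m) d₁) + 0
    ψG-v₁ = cong₂ _+_ (φ-at G v v₁ vv₁ deg-v≡ refl) (φ-non-edge ω G u v₁ (¬u-neighbour v₁≢w vv₁))

    ψH-v₁ : ψ ω H v₁ ≡ ω (rad 2 d₁) + 0
    ψH-v₁ = cong₂ _+_ (φ-at H v v₁ Hvv₁ deg-Hv (deg-off v₁ (proj₁ (v-neighbour-≢ vv₁)) (proj₂ (v-neighbour-≢ vv₁))))
                      (φ-non-edge ω H u v₁ Huv₁)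
      where
      Hvv₁ : H v v₁ ≡ true
      Hvv₁ rewrite row-s v₁ | other-q = vv₁
      Huv₁ : H u v₁ ≡ false
      Huv₁ rewrite row-t v₁ | other-q = ¬u-neighbour v₁≢w vv₁

    ψG-v₂ : ψ ω G v₂ ≡ ω (rad (2 + m) d₂) + 0
    ψG-v₂ = cong₂ _+_ (φ-at G v v₂ vv₂ deg-v≡ refl) (φ-non-edge ω G u v₂ (¬u-neighbour (proj₁ (proj₂ v₂-facts)) vv₂))

    ψH-v₂ : ψ ω H v₂ ≡ 0 + ω (rad (a + m) d₂)
    ψH-v₂ = cong₂ _+_ (φ-non-edge ω H v v₂ Hvv₂)
                      (φ-at H u v₂ Huv₂ deg-t (deg-off v₂ (proj₁ (v-neighbour-≢ vv₂)) (proj₂ (v-neighbour-≢ vv₂))))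
      where
      Hvv₂ : H v v₂ ≡ false
      Hvv₂ rewrite row-s v₂ | Mv₂ = refl
      Huv₂ : H u v₂ ≡ true
      Huv₂ rewrite row-t v₂ | Mv₂ = refl


    specials : ψ ω G w + (ψ ω G v₁ + (ψ ω G v₂ + 0)) + slack ≤ ψ ω H w + (ψ ω H v₁ + (ψ ω H v₂ + 0)) + 0
    specials = begin
      ψ ω G w + (ψ ω G v₁ + (ψ ω G v₂ + 0)) + slack ≡⟨ cong (_+ slack) (cong₂ _+_ ψG-w (cong₂ _+_ ψG-v₁ (cong (_+ 0) ψG-v₂))) ⟩
      P₁ + P₂ + (P₃ + 0 + (P₄ + 0 + 0)) + slack     ≡⟨ tidy P₁ P₂ P₃ P₄ slack ⟨
      P₁ + (P₂ + (P₃ + (P₄ + 0))) + slack * 1       ≤⟨ SqrtGap-scale slack 10000 _ 1 _ 0 gap ⟩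
      Q₁ + (Q₂ + (Q₃ + (Q₄ + 0))) + slack * 0       ≡⟨ tidy′ Q₁ Q₂ Q₃ Q₄ slack ⟩
      Q₁ + Q₂ + (Q₃ + 0 + (0 + Q₄ + 0)) + 0         ≡⟨ cong (_+ 0) (cong₂ _+_ ψH-w (cong₂ _+_ ψH-v₁ (cong (_+ 0) ψH-v₂))) ⟨
      ψ ω H w + (ψ ω H v₁ + (ψ ω H v₂ + 0)) + 0     ∎
      where
      open ≤-Reasoning
      P₁ = ω (rad (2 + m) 2)
      P₂ = ω (rad a 2)
      P₃ = ω (rad (2 + m) d₁)
      P₄ = ω (rad (2 + m) d₂)
      Q₁ = ω (rad 2 2)
      Q₂ = ω (rad (a + m) 2)
      Q₃ = ω (rad 2 d₁)
      Q₄ = ω (rad (a + m) d₂)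
      tidy : ∀ p q r s e → p + (q + (r + (s + 0))) + e * 1 ≡ p + q + (r + 0 + (s + 0 + 0)) + e
      tidy = solve-∀
      tidy′ : ∀ p q r s e → p + (q + (r + (s + 0))) + e * 0 ≡ p + q + (r + 0 + (0 + s + 0)) + 0
      tidy′ = solve-∀
      gap = gapA m a d₁ d₂ 1≤m (subst (_≤ a) deg-v≡ dv≤du)
              (neighbour-deg-pos vv₁) (v-neighbour-deg≤2 vv₁ v₁≢w)
              (neighbour-deg-pos vv₂) (v-neighbour-deg≤2 vv₂ (proj₁ (proj₂ v₂-facts)))

    rows : ∑ (φ ω G v) + ∑ (φ ω G u) + slack ≤ ∑ (φ ω H v) + ∑ (φ ω H u)
    rows = subst₂ _≤_ (cong (_+ slack) (∑-ψ ω G)) (trans (+-identityʳ _) (∑-ψ ω H))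
      (∑-≤-outside (w ∷ v₁ ∷ v₂ ∷ []) distinct
        (λ j j∉ → ψ-mono ω ω-mono dGv≤dHu j (λ vj → other-complete vj (j∉ ∘ here) (j∉ ∘ there ∘ here)))
        specials)
      where
      dGv≤dHu : deg G v ≤ deg H u
      dGv≤dHu = ≤-trans dv≤du (≤-trans (m≤m+n a m) (≤-reflexive (sym deg-t)))
      distinct = ((v₁≢w ∘ sym) ∷ (proj₁ (proj₂ v₂-facts) ∘ sym) ∷ []) ∷ ((proj₂ (proj₂ v₂-facts) ∘ sym) ∷ []) ∷ [] ∷ []

    part-a : SOlt G H
    part-a = SOlt-by-rows (slack * 10000) slack local-change (n<1+n (N * N)) rows

  module PartB (du<dv : deg G u < deg G v) where

    open OtherNeighbours G u y w renaming (other to Mb)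

    Mb⊆N[u]∖N[v] : ∀ z → Mb z ≡ true → G u z ≡ true × G v z ≡ false
    Mb⊆N[u]∖N[v] z Mz with other-sound Mz
    ... | uz , _ , z≢w = uz , ¬v-neighbour z≢w uz

    open Transfer G G-simple Mb u≢v uv Mb⊆N[u]∖N[v]

    private
      y∈C = proj₂ (CycEdge-∈ C uy)
      uy-edge = C-edge uy
      y≢w = ∉C-≢ y∈C w∉C
      vy : G v y ≡ false
      vy = ¬v-neighbour y≢w uy-edge
      vw : G v w ≡ true
      vw = trans (G-sym v w) wv
      dy = deg G y
      v-other : Fin N → Bool
      v-other j = G v j ∧ not (j == w)

    m : ℕ
    m = ∣M∣

    c : ℕ
    c = ∑ (𝟙 ∘ v-other)

    deg-u≡ : deg G u ≡ 2 + m
    deg-u≡ = deg-other uy-edge uw (y≢w ∘ sym)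

    deg-v≡ : deg G v ≡ 1 + c
    deg-v≡ = trans (deg-∑ G v) (∑-𝟙-remove (G v) vw)

    1≤m : 1 ≤ m
    1≤m = subst (1 ≤_) (sym (∑-𝟙-remove Mb Mx)) (s≤s z≤n)
      where
      x∈C = proj₁ (CycEdge-∈ C xu)
      Mx : Mb x ≡ true
      Mx = other-complete (trans (G-sym u x) (C-edge xu)) x≢y (∉C-≢ x∈C w∉C)

    m+2≤c : m + 2 ≤ c
    m+2≤c = ≤-pred (subst₂ _<_ (trans deg-u≡ (+-comm 2 m)) deg-v≡ du<dv)

    γ : ℕ
    γ = proj₁ (gapB m c 1≤m m+2≤c)

    edge-gap : EdgeGapB m c γ
    edge-gap = proj₁ (proj₂ (gapB m c 1≤m m+2≤c))

    main-gap : MainGapB m c γ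
    main-gap = proj₂ (proj₂ (gapB m c 1≤m m+2≤c))

    deg-Hu : deg H u ≡ 2
    deg-Hu = +-cancelʳ-≡ m (deg H u) 2 (trans deg-s deg-u≡)

    deg-Hv : deg H v ≡ 1 + c + m
    deg-Hv = trans deg-t (cong (_+ m) deg-v≡)

    gain : Fin N → ℕ
    gain j = 𝟙 (v-other j) * (slack * γ)

    ∑-gain : ∑ gain ≡ c * (slack * γ)
    ∑-gain = sym (*-distribʳ-sum (slack * γ) (𝟙 ∘ v-other))

    ψG-y : ψ ω G y ≡ ω (rad (2 + m) dy) + 0
    ψG-y = cong₂ _+_ (φ-at G u y uy-edge deg-u≡ refl) (φ-non-edge ω G v y vy)

    ψH-y : ψ ω H y ≡ ω (rad 2 dy) + 0
    ψH-y = cong₂ _+_ (φ-at H u y Huy deg-Hu (deg-off y (adjacent-≢ uy-edge ∘ sym) y≢v)) (φ-non-edge ω H v y Hvy)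
      where
      y≢v : y ≢ v
      y≢v refl = contradiction (trans (sym uy-edge) uv) true≢false
      Huy : H u y ≡ true
      Huy rewrite row-s y | other-p = uy-edge
      Hvy : H v y ≡ false
      Hvy rewrite row-t y | other-p = vy

    ψG-w : ψ ω G w ≡ ω (rad (2 + m) 2) + ω (rad (1 + c) 2)
    ψG-w = cong₂ _+_ (φ-at G u w uw deg-u≡ deg-w) (φ-at G v w vw deg-v≡ deg-w)

    ψH-w : ψ ω H w ≡ ω (rad 2 2) + ω (rad (1 + c + m) 2)
    ψH-w = cong₂ _+_ (φ-at H u w Huw deg-Hu deg-Hw) (φ-at H v w Hvw deg-Hv deg-Hw)
      where
      deg-Hw : deg H w ≡ 2
      deg-Hw = trans (deg-off w (adjacent-≢ uw ∘ sym) (adjacent-≢ wv)) deg-w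
      Huw : H u w ≡ true
      Huw rewrite row-s w | other-q = uw
      Hvw : H v w ≡ true
      Hvw rewrite row-t w | other-q = vw

    gain-off : ∀ {j} → v-other j ≡ false → gain j ≡ 0
    gain-off vo = cong (λ b → 𝟙 b * (slack * γ)) vo

    gain-y : gain y ≡ 0
    gain-y = gain-off (cong (_∧ not (y == w)) vy)

    gain-w : gain w ≡ 0
    gain-w = gain-off (trans (cong (λ b → G v w ∧ not b) (==-refl w)) (∧-zeroʳ (G v w)))

    edge-gain : ∀ j → v-other j ≡ true → ψ ω G j + gain j ≤ ψ ω H j
    edge-gain j vo = begin
      ψ ω G j + gain j                       ≡⟨ cong₂ _+_ ψG-j gain-j ⟩
      0 + ω (rad (1 + c) dj) + slack * γ     ≡⟨ pad (ω (rad (1 + c) dj)) (slack * γ) ⟩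
      ω (rad (1 + c) dj) + 0 + slack * γ     ≤⟨ SqrtGap-scale slack 10000 (rad (1 + c) dj ∷ []) γ (rad (1 + c + m) dj ∷ []) 0
                                                  (edge-gap dj (neighbour-deg-pos vj) (v-neighbour-deg≤2 vj j≢w)) ⟩
      ω (rad (1 + c + m) dj) + 0 + slack * 0 ≡⟨ unpad (ω (rad (1 + c + m) dj)) slack ⟩
      0 + ω (rad (1 + c + m) dj)             ≡⟨ ψH-j ⟨
      ψ ω H j                                ∎
      where
      open ≤-Reasoning
      pad : ∀ a g → 0 + a + g ≡ a + 0 + g
      pad = solve-∀
      unpad : ∀ a e → a + 0 + e * 0 ≡ 0 + a
      unpad = solve-∀
      dj = deg G j
      vj = proj₁ (∧-≡-true {G v j} vo)
      j≢w : j ≢ w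
      j≢w = ==-false⇒≢ (not-≡-true (proj₂ (∧-≡-true {G v j} vo)))
      uj = ¬u-neighbour j≢w vj
      dHj : deg H j ≡ dj
      dHj = deg-off j (proj₂ (v-neighbour-≢ vj)) (proj₁ (v-neighbour-≢ vj))
      ψG-j : ψ ω G j ≡ 0 + ω (rad (1 + c) dj)
      ψG-j = cong₂ _+_ (φ-non-edge ω G u j uj) (φ-at G v j vj deg-v≡ refl)
      gain-j : gain j ≡ slack * γ
      gain-j = trans (cong (λ b → 𝟙 b * (slack * γ)) vo) (*-identityˡ (slack * γ))
      Huj : H u j ≡ false
      Huj rewrite row-s j | uj = refl
      Hvj : H v j ≡ true
      Hvj rewrite row-t j | uj = vj
      ψH-j : ψ ω H j ≡ 0 + ω (rad (1 + c + m) dj)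
      ψH-j = cong₂ _+_ (φ-non-edge ω H u j Huj) (φ-at H v j Hvj deg-Hv dHj)

    specials : ψ ω G y + gain y + (ψ ω G w + gain w + 0) + slack ≤ ψ ω H y + (ψ ω H w + 0) + c * (slack * γ)
    specials = begin
      ψ ω G y + gain y + (ψ ω G w + gain w + 0) + slack ≡⟨ cong₂ (λ p q → p + q + slack)
                                                            (cong₂ _+_ ψG-y gain-y) (cong₂ (λ p q → p + q + 0) ψG-w gain-w) ⟩
      A + 0 + 0 + (P₁ + P₂ + 0 + 0) + slack            ≡⟨ tidy A P₁ P₂ slack ⟩
      A + (P₁ + P₂ + slack)                            ≤⟨ +-monoˡ-≤ _ (≤-trans (≤-reflexive (cong ω (split m dy))) split-bound) ⟩
      B + suc Q + (P₁ + P₂ + slack)                    ≡⟨ regroup B Q P₁ P₂ slack ⟩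
      B + (Q + (P₁ + (P₂ + 0)) + (1 + slack))          ≤⟨ +-monoʳ-≤ B (+-monoʳ-≤ _ 1+slack≤slack*2) ⟩
      B + (Q + (P₁ + (P₂ + 0)) + slack * 2)            ≤⟨ +-monoʳ-≤ B (SqrtGap-scale slack 10000 _ 2 _ (γ * c) main-gap) ⟩
      B + (R₁ + (R₂ + 0) + slack * (γ * c))           ≡⟨ final B R₁ R₂ slack γ c ⟩
      B + 0 + (R₁ + R₂ + 0) + c * (slack * γ)          ≡⟨ cong₂ (λ p q → p + q + c * (slack * γ)) ψH-y (cong (_+ 0) ψH-w) ⟨
      ψ ω H y + (ψ ω H w + 0) + c * (slack * γ)       ∎
      where
      open ≤-Reasoning
      A = ω (rad (2 + m) dy)
      B = ω (rad 2 dy)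
      Q = ω (4 * m + m * m)
      P₁ = ω (rad (2 + m) 2)
      P₂ = ω (rad (1 + c) 2)
      R₁ = ω (rad 2 2)
      R₂ = ω (rad (1 + c + m) 2)
      split : ∀ m d → (2 + m) * (2 + m) + d * d ≡ 2 * 2 + d * d + (4 * m + m * m)
      split = solve-∀
      split-bound : ω (rad 2 dy + (4 * m + m * m)) ≤ B + suc Q
      split-bound = ≤-pred (⌊√⌋-subadditive (slack * 10000) (rad 2 dy) (4 * m + m * m))
      tidy : ∀ a p q e → a + 0 + 0 + (p + q + 0 + 0) + e ≡ a + (p + q + e)
      tidy = solve-∀
      regroup : ∀ b q p₁ p₂ e → b + suc q + (p₁ + p₂ + e) ≡ b + (q + (p₁ + (p₂ + 0)) + (1 + e))
      regroup = solve-∀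
      double : ∀ e → e + e ≡ e * 2
      double = solve-∀
      1+slack≤slack*2 : 1 + slack ≤ slack * 2
      1+slack≤slack*2 = subst (1 + slack ≤_) (double slack) (+-monoˡ-≤ slack (s≤s z≤n))
      final : ∀ b r₁ r₂ e γ c → b + (r₁ + (r₂ + 0) + e * (γ * c)) ≡ b + 0 + (r₁ + r₂ + 0) + c * (e * γ)
      final = solve-∀

    rows : ∑ (φ ω G u) + ∑ (φ ω G v) + slack ≤ ∑ (φ ω H u) + ∑ (φ ω H v)
    rows = +-cancelʳ-≤ (c * (slack * γ)) (∑ (φ ω G u) + ∑ (φ ω G v) + slack) (∑ (φ ω H u) + ∑ (φ ω H v)) (begin
      ∑ (φ ω G u) + ∑ (φ ω G v) + slack + c * (slack * γ) ≡⟨ swap-last (∑ (φ ω G u) + ∑ (φ ω G v)) slack (c * (slack * γ)) ⟩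
      ∑ (φ ω G u) + ∑ (φ ω G v) + c * (slack * γ) + slack ≡⟨ cong (_+ slack) (cong₂ _+_ (∑-ψ ω G) ∑-gain) ⟨
      ∑ (ψ ω G) + ∑ gain + slack                          ≡⟨ cong (_+ slack) (∑-distrib-+ (ψ ω G) gain) ⟨
      ∑ (λ j → ψ ω G j + gain j) + slack                  ≤⟨ ∑-≤-outside (y ∷ w ∷ []) (((y≢w ∷ []) ∷ [] ∷ [])) outside specials ⟩
      ∑ (ψ ω H) + c * (slack * γ)                         ≡⟨ cong (_+ c * (slack * γ)) (∑-ψ ω H) ⟩
      ∑ (φ ω H u) + ∑ (φ ω H v) + c * (slack * γ)         ∎)
      where
      open ≤-Reasoning
      swap-last : ∀ a b c → a + b + c ≡ a + c + b
      swap-last = solve-∀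
      dGu≤dHv : deg G u ≤ deg H v
      dGu≤dHv = ≤-trans (<⇒≤ du<dv) (≤-trans (m≤m+n (deg G v) m) (≤-reflexive (sym deg-t)))
      outside : ∀ j → j ∉ y ∷ w ∷ [] → ψ ω G j + gain j ≤ ψ ω H j
      outside j j∉ = by-cases (v-other j) refl
        where
        by-cases : ∀ b → v-other j ≡ b → ψ ω G j + gain j ≤ ψ ω H j
        by-cases true  vo = edge-gain j vo
        by-cases false vo = begin
          ψ ω G j + gain j ≡⟨ trans (cong (ψ ω G j +_) (gain-off vo)) (+-identityʳ _) ⟩
          ψ ω G j          ≤⟨ ψ-mono ω ω-mono dGu≤dHv j (λ uj → other-complete uj (j∉ ∘ here) (j∉ ∘ there ∘ here)) ⟩
          ψ ω H j          ∎

    part-b : SOlt G H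
    part-b = SOlt-by-rows (slack * 10000) slack local-change (n<1+n (N * N)) rows

lemma3p5 : ∀ {N k : ℕ} (G : Adj N) (C : List (Fin N)) (x u y w v : Fin N) →
  InU k G C →
  x ≢ y → CycEdge C x u → CycEdge C u y →
  w ∉ C → v ∉ C → G u w ≡ true → G w v ≡ true →
  deg G w ≡ 2 → 3 ≤ deg G v →
  (∀ z → Reach (deleteEdge G u w) w z → 3 ≤ deg G z → z ≡ v) →
  ((deg G v ≤ deg G u → ∀ (v₁ : Fin N) → G v v₁ ≡ true → v₁ ≢ w →
      SOlt G (transfer G (λ z → G v z ∧ not (z == w) ∧ not (z == v₁)) v u))
  × (deg G u < deg G v →
      SOlt G (transfer G (λ z → G u z ∧ not (z == y) ∧ not (z == w)) u v)))
lemma3p5 G C x u y w v G∈U x≢y xu uy w∉C v∉C uw wv deg-w deg-v T*-branching =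
  PartA.part-a , PartB.part-b
  where open Configuration G C x u y w v G∈U x≢y xu uy w∉C v∉C uw wv deg-w deg-v T*-branching
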